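{- Let $g$ be an even integer and let $G$ be a $3$-regular graph of girth $g$ with $n_g$ vertices that contains two vertices at distance at least $g/2$. Let $k\ge 1$ and $t\in\{0,1,2\}$ be integers and put $m=3k+t$. Then there exists a graph of girth $g$ in which every vertex has degree $3$ or $m$ (a $(3,m;g)$-graph), whose number of vertices is \[ k(n_g-2)+\begin{cases} 2 & \text{if } t=0,\\ n_g+2 & \text{if } t=1,\\ n_g & \text{if } t=2.\end{cases}\]
   Context: A $(3,m;g)$-graph is a simple finite graph of girth $g$ (length of a shortest cycle) in which every vertex has degree either $3$ or $m$. -}

module Defs where

open import Data.Nat using (ℕ; zero; suc; _+_; _*_; _≤_; _<_)
open import Data.Fin using (Fin; zero; suc; inject₁; fromℕ)
open import Data.Bool using (Bool; true; false; if_then_else_)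
open import Data.List using (map; allFin)
open import Data.Nat.ListAction using (sum)
open import Data.Product using (Σ; _×_)
open import Data.Empty using (⊥)
open import Function.Definitions using (Injective)
open import Relation.Binary.PropositionalEquality using (_≡_)
open import Relation.Nullary using (¬_)

record Graph (n : ℕ) : Set where
  field
    adj    : Fin n → Fin n → Bool
    sym    : ∀ u v → adj u v ≡ adj v u
    irrefl : ∀ v → adj v v ≡ false
open Graph public

Adj : ∀ {n} → Graph n → Fin n → Fin n → Set
Adj G u v = adj G u v ≡ true

deg : ∀ {n} → Graph n → Fin n → ℕ
deg {n} G v = sum (map (λ w → if adj G v w then 1 else 0) (allFin n))

record Walk {n} (G : Graph n) (ℓ : ℕ) (u v : Fin n) : Set where
  field
    p     : Fin (suc ℓ) → Fin n
    start : p zero ≡ u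
    end   : p (fromℕ ℓ) ≡ v
    steps : ∀ (i : Fin ℓ) → Adj G (p (inject₁ i)) (p (suc i))

-- distance from u to v is at least d (no walk of length < d; infinite distance allowed)
DistAtLeast : ∀ {n} → Graph n → Fin n → Fin n → ℕ → Set
DistAtLeast G u v d = ∀ ℓ → ℓ < d → ¬ Walk G ℓ u v

HasCycle : ∀ {n} → Graph n → ℕ → Set
HasCycle G zero = ⊥
HasCycle {n} G (suc k) =
  3 ≤ suc k ×
  Σ (Fin (suc k) → Fin n) λ c →
    Injective _≡_ _≡_ c ×
    (∀ (i : Fin k) → Adj G (c (inject₁ i)) (c (suc i))) ×
    Adj G (c (fromℕ k)) (c zero)

HasGirth : ∀ {n} → Graph n → ℕ → Set
HasGirth G g = HasCycle G g × (∀ ℓ → ℓ < g → ¬ HasCycle G ℓ)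

extra : Fin 3 → ℕ → ℕ
extra zero ng = 2
extra (suc zero) ng = ng + 2
extra (suc (suc zero)) ng = ng

-- Put D = g/2 and move the two vertices of G at distance ≥ D to 0 and 1. Call a graph with two ends 0, 1 of
-- equal degree d, all other vertices cubic, girth ≥ 2D and a 1-Lipschitz potential that is 0 at end 0 and D at
-- end 1 a gadget: the potential forces every cycle through both ends to have length ≥ 2D. Gluing two gadgets at
-- their ends adds the end degrees and gives a gadget again, because a cycle that uses both of them passes through
-- both ends. G is a gadget of end degree 3 (with min(D, dist(0, ·)) as potential); deleting an edge 0y and hanging
-- new ends at 0 and y gives one of end degree 1; two copies of G, with an edge at 1 deleted in one and an edge at 0
-- in the other and the two freed vertices joined, give one of end degree 5. As deleting an edge pq of G leaves p
-- and q at distance ≥ 2D − 1, the new edges create no short cycles. Gluing k copies of G alone, onto the degree-1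
-- gadget, or k − 1 of them onto the degree-5 gadget gives end degree 3k, 3k + 1, 3k + 2 with the stated numbers
-- of vertices, and a shortest cycle of G survives in the result, so its girth is exactly g.

module Submission where

open import Defs renaming (sym to adj-sym; irrefl to adj-irrefl)
open import Data.Bool using (Bool; true; false; if_then_else_; _∧_; _∨_; not)
open import Data.Bool.Properties using (∨-comm; ∧-comm; ∧-zeroʳ) renaming (_≟_ to _≟ᵇ_)
open import Data.Empty using (⊥-elim)
open import Data.Fin using (Fin; zero; suc; toℕ; fromℕ; fromℕ<; inject₁; punchOut; _↑ˡ_; _↑ʳ_; splitAt; join)
open import Data.Fin.Patterns using (0F; 1F; 2F)
open import Data.Fin.Permutation using (Permutation′; _⟨$⟩ʳ_; _⟨$⟩ˡ_; inverseˡ; inverseʳ; insert) renaming (id to idₚ)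
open import Data.Fin.Properties
  using (toℕ-injective; toℕ<n; toℕ-fromℕ; toℕ-fromℕ<; toℕ-inject₁; any?; splitAt-↑ˡ; splitAt-↑ʳ; join-splitAt; punchIn-punchOut)
  renaming (_≟_ to _≟ᶠ_)
open import Data.List using (map; tabulate)
open import Data.List.Properties using (map-tabulate)
import Data.Nat.ListAction as List
open import Data.Nat using (ℕ; zero; suc; _+_; _*_; _∸_; _/_; _%_; _≤_; _<_; z≤n; s≤s; s≤s⁻¹; _≤?_; _<?_; NonZero; >-nonZero)
open import Data.Nat.DivMod
open import Data.Nat.Divisibility using (_∣_; divides)
open import Data.Nat.Induction using (<-rec)
open import Data.Nat.Properties
open import Data.Nat.Tactic.RingSolver using (solve-∀)
open import Algebra.Properties.CommutativeMonoid.Sum +-0-commutativeMonoid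
  using (sum-cong-≗; ∑-distrib-+; ∑-permute) renaming (sum to ∑)
open import Data.Product using (Σ; _×_; _,_; proj₁; proj₂; ∃; swap)
open import Data.Sum using (_⊎_; inj₁; inj₂)
open import Function using (id; _∘_)
open import Relation.Binary using (tri<; tri≈; tri>)
open import Relation.Binary.PropositionalEquality
open import Relation.Nullary using (¬_; Dec; yes; no; does; ¬?; _×-dec_)
open import Relation.Nullary.Decidable using (dec-true)
open import Relation.Unary using (Decidable)

-- Counting neighbours

false≢true : false ≢ true
false≢true ()

adj⇒≢ : ∀ {n} (G : Graph n) {p q} → Adj G p q → p ≢ q
adj⇒≢ G {p} p~q refl = false≢true (trans (sym (adj-irrefl G p)) p~q)

bit : Bool → ℕ
bit true = 1
bit false = 0

∑-tabulate : ∀ {n} (f : Fin n → ℕ) → List.sum (tabulate f) ≡ ∑ f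
∑-tabulate {zero} f = refl
∑-tabulate {suc n} f = cong (f zero +_) (∑-tabulate (f ∘ suc))

deg≡∑ : ∀ {n} (G : Graph n) v → deg G v ≡ ∑ (λ w → bit (adj G v w))
deg≡∑ {n} G v = begin
  List.sum (map f (tabulate id)) ≡⟨ cong List.sum (map-tabulate id f) ⟩
  List.sum (tabulate f)          ≡⟨ ∑-tabulate f ⟩
  ∑ f                            ≡⟨ sum-cong-≗ (if-bit ∘ adj G v) ⟩
  ∑ (λ w → bit (adj G v w))      ∎
  where
  open ≡-Reasoning
  f : Fin n → ℕ
  f w = if adj G v w then 1 else 0
  if-bit : ∀ b → (if b then 1 else 0) ≡ bit b
  if-bit true = refl
  if-bit false = refl

∑-mono-≤ : ∀ {n} {f g : Fin n → ℕ} → (∀ i → f i ≤ g i) → ∑ f ≤ ∑ g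
∑-mono-≤ {zero} le = z≤n
∑-mono-≤ {suc n} le = +-mono-≤ (le zero) (∑-mono-≤ (le ∘ suc))

∑-zero : ∀ {n} (f : Fin n → ℕ) → (∀ i → f i ≡ 0) → ∑ f ≡ 0
∑-zero {zero} f z = refl
∑-zero {suc n} f z rewrite z zero = ∑-zero (f ∘ suc) (z ∘ suc)

∑-↑ : ∀ m {r} (f : Fin (m + r) → ℕ) → ∑ f ≡ ∑ (λ i → f (i ↑ˡ r)) + ∑ (λ j → f (m ↑ʳ j))
∑-↑ zero f = refl
∑-↑ (suc m) {r} f rewrite ∑-↑ m {r} (f ∘ suc) =
  sym (+-assoc (f zero) (∑ (λ i → f (suc (i ↑ˡ r)))) (∑ (λ j → f (suc (m ↑ʳ j)))))

_==_ : ∀ {n} → Fin n → Fin n → Bool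
zero  == zero  = true
zero  == suc _ = false
suc _ == zero  = false
suc i == suc j = i == j

==-refl : ∀ {n} (i : Fin n) → (i == i) ≡ true
==-refl zero = refl
==-refl (suc i) = ==-refl i

==⇒≡ : ∀ {n} {i j : Fin n} → (i == j) ≡ true → i ≡ j
==⇒≡ {i = zero} {zero} e = refl
==⇒≡ {i = suc i} {suc j} e = cong suc (==⇒≡ e)

≢⇒==-false : ∀ {n} {i j : Fin n} → i ≢ j → (i == j) ≡ false
≢⇒==-false {i = zero} {zero} i≢j = ⊥-elim (i≢j refl)
≢⇒==-false {i = zero} {suc j} i≢j = refl
≢⇒==-false {i = suc i} {zero} i≢j = refl
≢⇒==-false {i = suc i} {suc j} i≢j = ≢⇒==-false (i≢j ∘ cong suc)

∑-point : ∀ {n} (p : Fin n) → ∑ (λ i → bit (i == p)) ≡ 1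
∑-point {suc n} zero = cong suc (∑-zero {n} (λ i → bit (suc i == zero)) (λ i → refl))
∑-point {suc n} (suc p) = ∑-point p

∑-point-∧ : ∀ {n} b (p : Fin n) → ∑ (λ i → bit (b ∧ (i == p))) ≡ bit b
∑-point-∧ true p = ∑-point p
∑-point-∧ {n} false p = ∑-zero {n} (λ _ → 0) (λ _ → refl)

∧-true : ∀ {a b} → a ∧ b ≡ true → a ≡ true × b ≡ true
∧-true {true} b≡true = refl , b≡true

bit-partition : ∀ a b c → (b ≡ true → a ≡ true) → (c ≡ true → a ≡ true) → (b ≡ true → c ≡ false) →
                bit (a ∧ not (b ∨ c)) + bit b + bit c ≡ bit a
bit-partition a     true  true  _   _   b⇒¬c = ⊥-elim (false≢true (sym (b⇒¬c refl)))
bit-partition a     true  false b⇒a _   _ rewrite b⇒a refl = refl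
bit-partition a     false true  _   c⇒a _ rewrite c⇒a refl = refl
bit-partition true  false false _   _   _ = refl
bit-partition false false false _   _   _ = refl

-- Walks, cycles and potentials

-- Walks and cycles are ℕ-indexed: a walk is read only on 0 … ℓ and a cycle is an L-periodic sequence, which keeps
-- all index arithmetic in ℕ. walk′⇒walk, hasCycle⇒cycle and cycle⇒hasCycle translate to the notions of Defs.
record Walk′ {n} (G : Graph n) (ℓ : ℕ) (x y : Fin n) : Set where
  field
    w     : ℕ → Fin n
    start : w 0 ≡ x
    end   : w ℓ ≡ y
    steps : ∀ s → s < ℓ → Adj G (w s) (w (suc s))

DistAtLeast′ : ∀ {n} → Graph n → Fin n → Fin n → ℕ → Set
DistAtLeast′ G x y D = ∀ ℓ → ℓ < D → ¬ Walk′ G ℓ x y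

walk′⇒walk : ∀ {n} {G : Graph n} {ℓ x y} → Walk′ G ℓ x y → Walk G ℓ x y
walk′⇒walk {G = G} {ℓ} W = record
  { p     = λ i → w (toℕ i)
  ; start = start
  ; end   = trans (cong w (toℕ-fromℕ ℓ)) end
  ; steps = λ i → subst (λ s → Adj G (w s) (w (suc (toℕ i)))) (sym (toℕ-inject₁ i)) (steps (toℕ i) (toℕ<n i)) }
  where open Walk′ W

distAtLeast⇒distAtLeast′ : ∀ {n} {G : Graph n} {x y D} → DistAtLeast G x y D → DistAtLeast′ G x y D
distAtLeast⇒distAtLeast′ d ℓ ℓ<D W = d ℓ ℓ<D (walk′⇒walk W)

mapWalk : ∀ {n} {G H : Graph n} → (∀ {x y} → Adj G x y → Adj H x y) → ∀ {ℓ x y} → Walk′ G ℓ x y → Walk′ H ℓ x y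
mapWalk G⊆H W = record { w = w ; start = start ; end = end ; steps = λ s s<ℓ → G⊆H (steps s s<ℓ) }
  where open Walk′ W

trivialWalk : ∀ {n} {G : Graph n} {x y} → x ≡ y → Walk′ G 0 x y
trivialWalk {x = x} x≡y = record { w = λ _ → x ; start = refl ; end = x≡y ; steps = λ _ () }

snoc : ∀ {n} {G : Graph n} {ℓ x y z} → Walk′ G ℓ x y → Adj G y z → Walk′ G (suc ℓ) x z
snoc {G = G} {ℓ} {z = z} W y~z = record { w = w′ ; start = start′ ; end = end′ ; steps = steps′ }
  where
  open Walk′ W
  w′ : ℕ → _
  w′ t with t ≤? ℓ
  ... | yes _ = w t
  ... | no  _ = z
  start′ : w′ 0 ≡ _
  start′ with 0 ≤? ℓ
  ... | yes _ = start
  ... | no 0≰ℓ = ⊥-elim (0≰ℓ z≤n)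
  end′ : w′ (suc ℓ) ≡ z
  end′ with suc ℓ ≤? ℓ
  ... | yes ℓ<ℓ = ⊥-elim (<-irrefl refl ℓ<ℓ)
  ... | no  _ = refl
  steps′ : ∀ t → t < suc ℓ → Adj G (w′ t) (w′ (suc t))
  steps′ t t<1+ℓ with t ≤? ℓ | suc t ≤? ℓ
  ... | yes _   | yes t<ℓ = steps t t<ℓ
  ... | yes t≤ℓ | no t≮ℓ  = subst (λ s → Adj G (w s) z) (≤-antisym (≮⇒≥ t≮ℓ) t≤ℓ) (subst (λ v → Adj G v z) (sym end) y~z)
  ... | no t≰ℓ  | _       = ⊥-elim (t≰ℓ (s≤s⁻¹ t<1+ℓ))

Lipschitz : ∀ {n} → Graph n → (Fin n → ℕ) → Set
Lipschitz G h = ∀ x y → Adj G x y → h y ≤ suc (h x)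

Gap : ℕ → ℕ → ℕ → Set
Gap a b d = a ≤ b + d × b ≤ a + d

module _ {n} {G : Graph n} {h : Fin n → ℕ} (lip : Lipschitz G h) where

  gap-along : (w : ℕ → Fin n) → ∀ ℓ → (∀ s → s < ℓ → Adj G (w s) (w (suc s))) → Gap (h (w 0)) (h (w ℓ)) ℓ
  gap-along w zero _ = m≤m+n _ 0 , m≤m+n _ 0
  gap-along w (suc ℓ) steps =
    ≤-trans back (≤-reflexive (sym (+-suc _ ℓ))) , ≤-trans forth (≤-reflexive (sym (+-suc _ ℓ)))
    where
    ih = gap-along w ℓ (λ s s<ℓ → steps s (m<n⇒m<1+n s<ℓ))
    w~w′ = steps ℓ ≤-refl
    back : h (w 0) ≤ suc (h (w (suc ℓ)) + ℓ)
    back = ≤-trans (proj₁ ih) (+-monoˡ-≤ ℓ (lip _ _ (trans (adj-sym G _ _) w~w′)))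
    forth : h (w (suc ℓ)) ≤ suc (h (w 0) + ℓ)
    forth = ≤-trans (lip _ _ w~w′) (s≤s (proj₂ ih))

  walk-rise≤length : ∀ {ℓ x y} → Walk′ G ℓ x y → h x ≤ h y + ℓ
  walk-rise≤length {ℓ} W = subst₂ (λ a b → h a ≤ h b + ℓ) start end (proj₁ (gap-along w ℓ steps))
    where open Walk′ W

record Cycle {n} (G : Graph n) (L : ℕ) : Set where
  field
    c        : ℕ → Fin n
    3≤L      : 3 ≤ L
    step     : ∀ s → Adj G (c s) (c (suc s))
    period   : ∀ s → c (s + L) ≡ c s
    distinct : ∀ p q → p < q → q < p + L → c p ≢ c q

  instance
    L-nonZero : NonZero L
    L-nonZero = >-nonZero (≤-trans (s≤s z≤n) 3≤L)

  periodic : ∀ s k → c (s + k * L) ≡ c s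
  periodic s zero = cong c (+-identityʳ s)
  periodic s (suc k) = begin
    c (s + (L + k * L)) ≡⟨ cong c (trans (cong (s +_) (+-comm L (k * L))) (sym (+-assoc s (k * L) L))) ⟩
    c (s + k * L + L)   ≡⟨ period (s + k * L) ⟩
    c (s + k * L)       ≡⟨ periodic s k ⟩
    c s                 ∎
    where open ≡-Reasoning

  c-% : ∀ s → c s ≡ c (s % L)
  c-% s = trans (cong c (m≡m%n+[m/n]*n s L)) (periodic (s % L) (s / L))

GirthAtLeast : ∀ {n} → Graph n → ℕ → Set
GirthAtLeast G B = ∀ L → Cycle G L → B ≤ L

mapCycle : ∀ {n m} {G : Graph n} {H : Graph m} {L} (C : Cycle G L) (f : Fin n → Fin m) →
  (∀ s → Adj H (f (Cycle.c C s)) (f (Cycle.c C (suc s)))) →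
  (∀ s t → f (Cycle.c C s) ≡ f (Cycle.c C t) → Cycle.c C s ≡ Cycle.c C t) → Cycle H L
mapCycle C f step′ f-inj = record
  { c        = λ s → f (c s)
  ; 3≤L      = 3≤L
  ; step     = step′
  ; period   = λ s → cong f (period s)
  ; distinct = λ p q p<q q<p+L e → distinct p q p<q q<p+L (f-inj p q e) }
  where open Cycle C

module _ {n} {G : Graph n} {h : Fin n → ℕ} (lip : Lipschitz G h) {L} (C : Cycle G L) where
  open Cycle C

  gap-arcs : ∀ p d₁ d₂ → d₁ + d₂ ≡ L → Gap (h (c p)) (h (c (p + d₁))) d₁ × Gap (h (c p)) (h (c (p + d₁))) d₂
  gap-arcs p d₁ d₂ d₁+d₂≡L = along p d₁ , swap (subst (λ v → Gap (h (c (p + d₁))) (h v) d₂) wraps (along (p + d₁) d₂))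
    where
    along : ∀ s d → Gap (h (c s)) (h (c (s + d))) d
    along s d = subst (λ u → Gap (h (c u)) (h (c (s + d))) d) {x = s + 0} (+-identityʳ s)
      (gap-along {G = G} {h = h} lip (λ t → c (s + t)) d (λ t _ → subst (λ u → Adj G (c (s + t)) (c u)) (sym (+-suc s t)) (step (s + t))))
    wraps : c (p + d₁ + d₂) ≡ c p
    wraps = trans (cong c (trans (+-assoc p d₁ d₂) (cong (p +_) d₁+d₂≡L))) (period p)

  both-arcs≥ : ∀ {a b D} → a < b → b < L → (∀ {d} → Gap (h (c a)) (h (c b)) d → D ≤ d) → D + D ≤ L
  both-arcs≥ {a} {b} {D} a<b b<L rise = subst (D + D ≤_) d₁+d₂≡L (+-mono-≤ (rise (proj₁ arcs)) (rise (proj₂ arcs)))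
    where
    d₁ = proj₁ (m≤n⇒∃[o]m+o≡n (<⇒≤ a<b))
    a+d₁≡b : a + d₁ ≡ b
    a+d₁≡b = proj₂ (m≤n⇒∃[o]m+o≡n (<⇒≤ a<b))
    d₂ = proj₁ (m≤n⇒∃[o]m+o≡n (≤-trans (<⇒≤ b<L) (m≤n+m L a)))
    d₁+d₂≡L : d₁ + d₂ ≡ L
    d₁+d₂≡L = +-cancelˡ-≡ a _ _ (trans (sym (+-assoc a d₁ d₂))
                (trans (cong (_+ d₂) a+d₁≡b) (proj₂ (m≤n⇒∃[o]m+o≡n (≤-trans (<⇒≤ b<L) (m≤n+m L a))))))
    arcs : Gap (h (c a)) (h (c b)) d₁ × Gap (h (c a)) (h (c b)) d₂
    arcs = subst (λ v → Gap (h (c a)) (h (c v)) d₁ × Gap (h (c a)) (h (c v)) d₂) a+d₁≡b (gap-arcs a d₁ d₂ d₁+d₂≡L)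

  h-% : ∀ {v} s → h (c s) ≡ v → h (c (s % L)) ≡ v
  h-% s e = trans (cong h (sym (c-% s))) e

  twice-rise≤length : ∀ {p q D} → 0 < D → h (c p) ≡ 0 → h (c q) ≡ D → D + D ≤ L
  twice-rise≤length {p} {q} {D} 0<D hp hq with <-cmp (p % L) (q % L)
  ... | tri≈ _ p≡q _ = ⊥-elim (<⇒≢ 0<D (trans (sym (h-% p hp)) (trans (cong (λ s → h (c s)) p≡q) (h-% q hq))))
  ... | tri< p<q _ _ = both-arcs≥ p<q (m%n<n q L) (λ g → subst₂ (λ x y → y ≤ x + _) (h-% p hp) (h-% q hq) (proj₂ g))
  ... | tri> _ _ q<p = both-arcs≥ q<p (m%n<n p L) (λ g → subst₂ (λ x y → y ≤ x + _) (h-% p hp) (h-% q hq) (proj₁ g))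

module _ (L : ℕ) .{{_ : NonZero L}} where

  suc-% : ∀ s → suc s % L ≡ suc (s % L) % L
  suc-% s = begin
    suc s % L                   ≡⟨ cong (λ t → suc t % L) (m≡m%n+[m/n]*n s L) ⟩
    (suc (s % L) + s / L * L) % L ≡⟨ [m+kn]%n≡m%n (suc (s % L)) (s / L) L ⟩
    suc (s % L) % L             ∎
    where open ≡-Reasoning

  -- Equal residues would make q − p a multiple of L strictly between 0 and L.
  %-distinct : ∀ p q → p < q → q < p + L → p % L ≢ q % L
  %-distinct p q p<q q<p+L p%≡q% = <⇒≱ a<b (s≤s⁻¹ b<1+a)
    where
    r = p % L
    a = p / L
    b = q / L
    p≡ : p ≡ r + a * L
    p≡ = m≡m%n+[m/n]*n p L
    q≡ : q ≡ r + b * L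
    q≡ = trans (m≡m%n+[m/n]*n q L) (cong (_+ b * L) (sym p%≡q%))
    p+L≡ : p + L ≡ r + suc a * L
    p+L≡ = trans (cong (_+ L) p≡) (trans (+-assoc r (a * L) L) (cong (r +_) (+-comm (a * L) L)))
    a<b : a < b
    a<b = *-cancelʳ-< L a b (+-cancelˡ-< r _ _ (subst₂ _<_ p≡ q≡ p<q))
    b<1+a : b < suc a
    b<1+a = *-cancelʳ-< L b (suc a) (+-cancelˡ-< r _ _ (subst₂ _<_ q≡ p+L≡ q<p+L))

hasCycle⇒cycle : ∀ {n} {G : Graph n} L → HasCycle G L → Cycle G L
hasCycle⇒cycle {G = G} (suc K) (3≤L , c , c-inj , steps , close) = record
  { c        = λ s → c (idx s)
  ; 3≤L      = 3≤L
  ; step     = step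
  ; period   = λ s → cong c (toℕ-injective (trans (toℕ-idx (s + L)) (trans ([m+n]%n≡m%n s L) (sym (toℕ-idx s)))))
  ; distinct = λ p q p<q q<p+L e →
      %-distinct L p q p<q q<p+L (trans (sym (toℕ-idx p)) (trans (cong toℕ (c-inj e)) (toℕ-idx q))) }
  where
  L = suc K
  idx : ℕ → Fin L
  idx s = fromℕ< (m%n<n s L)
  toℕ-idx : ∀ s → toℕ (idx s) ≡ s % L
  toℕ-idx s = toℕ-fromℕ< (m%n<n s L)
  step : ∀ s → Adj G (c (idx s)) (c (idx (suc s)))
  step s with suc (s % L) <? L
  ... | yes 1+r<L = subst₂ (λ i j → Adj G (c i) (c j)) here next (steps i)
    where
    i : Fin K
    i = fromℕ< (s≤s⁻¹ 1+r<L)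
    here : inject₁ i ≡ idx s
    here = toℕ-injective (trans (toℕ-inject₁ i) (trans (toℕ-fromℕ< (s≤s⁻¹ 1+r<L)) (sym (toℕ-idx s))))
    next : suc i ≡ idx (suc s)
    next = toℕ-injective (trans (cong suc (toℕ-fromℕ< (s≤s⁻¹ 1+r<L)))
             (sym (trans (toℕ-idx (suc s)) (trans (suc-% L s) (m<n⇒m%n≡m 1+r<L)))))
  ... | no 1+r≮L = subst₂ (λ i j → Adj G (c i) (c j)) last first close
    where
    r≡K : s % L ≡ K
    r≡K = ≤-antisym (s≤s⁻¹ (m%n<n s L)) (s≤s⁻¹ (≮⇒≥ 1+r≮L))
    last : fromℕ K ≡ idx s
    last = toℕ-injective (trans (toℕ-fromℕ K) (trans (sym r≡K) (sym (toℕ-idx s))))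
    first : zero ≡ idx (suc s)
    first = toℕ-injective (sym (trans (toℕ-idx (suc s)) (trans (suc-% L s) (trans (cong (λ t → suc t % L) r≡K) (n%n≡0 L)))))

cycle⇒hasCycle : ∀ {n} {G : Graph n} L → Cycle G L → HasCycle G L
cycle⇒hasCycle zero C with Cycle.3≤L C
... | ()
cycle⇒hasCycle {G = G} (suc K) C = 3≤L , (λ i → c (toℕ i)) , c-inj , steps , close
  where
  open Cycle C
  c-inj : ∀ {i j : Fin (suc K)} → c (toℕ i) ≡ c (toℕ j) → i ≡ j
  c-inj {i} {j} e with <-cmp (toℕ i) (toℕ j)
  ... | tri≈ _ i≡j _ = toℕ-injective i≡j
  ... | tri< i<j _ _ = ⊥-elim (distinct _ _ i<j (≤-trans (toℕ<n j) (m≤n+m _ _)) e)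
  ... | tri> _ _ j<i = ⊥-elim (distinct _ _ j<i (≤-trans (toℕ<n i) (m≤n+m _ _)) (sym e))
  steps : ∀ (i : Fin K) → Adj G (c (toℕ (inject₁ i))) (c (suc (toℕ i)))
  steps i = subst (λ s → Adj G (c s) (c (suc (toℕ i)))) (sym (toℕ-inject₁ i)) (step (toℕ i))
  close : Adj G (c (toℕ (fromℕ K))) (c 0)
  close = subst₂ (λ s v → Adj G (c s) v) (sym (toℕ-fromℕ K)) (period 0) (step K)

module _ {n} {G : Graph n} {L} (C : Cycle G L) where
  open Cycle C

  L∸1+1 : suc (L ∸ 1) ≡ L
  L∸1+1 = trans (+-comm 1 (L ∸ 1)) (m∸n+n≡m (≤-trans (s≤s z≤n) 3≤L))

  step-back : ∀ s → Adj G (c (s + (L ∸ 1))) (c s)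
  step-back s = subst (Adj G (c (s + (L ∸ 1)))) (trans (cong c (trans (sym (+-suc s (L ∸ 1))) (cong (s +_) L∸1+1))) (period s))
                  (step (s + (L ∸ 1)))

  residue-injective : ∀ {a b} → a < L → b < L → c a ≡ c b → a ≡ b
  residue-injective {a} {b} a<L b<L e with <-cmp a b
  ... | tri≈ _ a≡b _ = a≡b
  ... | tri< a<b _ _ = ⊥-elim (distinct a b a<b (≤-trans b<L (m≤n+m L a)) e)
  ... | tri> _ _ b<a = ⊥-elim (distinct b a b<a (≤-trans a<L (m≤n+m L b)) (sym e))

  c-shift : ∀ s t → c (s + t) ≡ c (s % L + t)
  c-shift s t = begin
    c (s + t)                   ≡⟨ cong (λ u → c (u + t)) (m≡m%n+[m/n]*n s L) ⟩
    c (s % L + s / L * L + t)   ≡⟨ cong c (trans (+-assoc (s % L) _ t) (trans (cong (s % L +_) (+-comm _ t)) (sym (+-assoc (s % L) t _)))) ⟩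
    c (s % L + t + s / L * L)   ≡⟨ periodic (s % L + t) (s / L) ⟩
    c (s % L + t)               ∎
    where open ≡-Reasoning

  -- The cycle visits v at most once per period, so p and q are well defined (and arbitrary if v is off the cycle).
  cycle-neighbours : ∀ v → Σ (Fin n) λ p → Σ (Fin n) λ q →
                     (∀ s → c s ≡ v → c (suc s) ≡ p) × (∀ s → c (suc s) ≡ v → c s ≡ q)
  cycle-neighbours v with anyUpTo? (λ k → c k ≟ᶠ v) L
  ... | no never = v , v , (λ s e → ⊥-elim (never (s % L , m%n<n s L , trans (sym (c-% s)) e)))
                         , (λ s e → ⊥-elim (never (suc s % L , m%n<n (suc s) L , trans (sym (c-% (suc s))) e)))
  ... | yes (s₀ , s₀<L , cs₀≡v) = c (suc s₀) , c (s₀ + (L ∸ 1)) , successor , predecessor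
    where
    at-s₀ : ∀ s → c s ≡ v → s % L ≡ s₀
    at-s₀ s e = residue-injective (m%n<n s L) s₀<L (trans (sym (c-% s)) (trans e (sym cs₀≡v)))
    successor : ∀ s → c s ≡ v → c (suc s) ≡ c (suc s₀)
    successor s e = trans (cong c (+-comm 1 s)) (trans (c-shift s 1) (cong c (trans (cong (_+ 1) (at-s₀ s e)) (+-comm s₀ 1))))
    predecessor : ∀ s → c (suc s) ≡ v → c s ≡ c (s₀ + (L ∸ 1))
    predecessor s e = begin
      c s                         ≡⟨ sym (period s) ⟩
      c (s + L)                   ≡⟨ cong c (trans (cong (s +_) (sym L∸1+1)) (+-suc s (L ∸ 1))) ⟩
      c (suc s + (L ∸ 1))         ≡⟨ c-shift (suc s) (L ∸ 1) ⟩
      c (suc s % L + (L ∸ 1))     ≡⟨ cong (λ u → c (u + (L ∸ 1))) (at-s₀ (suc s) e) ⟩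
      c (s₀ + (L ∸ 1))            ∎
      where open ≡-Reasoning

  -- A leaf's two neighbours on the cycle would coincide.
  leaf-off-cycle : ∀ {v w} → (∀ u → Adj G v u → u ≡ w) → ∀ s → c s ≢ v
  leaf-off-cycle {v} only-w s cs≡v =
    distinct (suc s) (s + (L ∸ 1)) 1+s<s+L∸1 s+L∸1<1+s+L
      (trans (only-w _ (subst (λ u → Adj G u (c (suc s))) cs≡v (step s)))
             (sym (only-w _ (subst (λ u → Adj G u (c (s + (L ∸ 1)))) cs≡v (trans (adj-sym G _ _) (step-back s))))))
    where
    1+s<s+L∸1 : suc s < s + (L ∸ 1)
    1+s<s+L∸1 = subst (_≤ s + (L ∸ 1)) (+-comm s 2) (+-monoʳ-≤ s (∸-monoˡ-≤ 1 3≤L))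
    s+L∸1<1+s+L : s + (L ∸ 1) < suc s + L
    s+L∸1<1+s+L = s≤s (+-monoʳ-≤ s (m∸n≤m L 1))

-- Capped distance

-- potential D z counts the rounds i < D of breadth-first search from s that have not yet reached z,
-- so it is min(D, dist(s, z)).
module CappedDistance {n} (G : Graph n) (s : Fin n) where

  reached : ℕ → Fin n → Bool
  reached zero    z = z == s
  reached (suc j) z = reached j z ∨ does (any? (λ w → reached j w ∧ adj G w z ≟ᵇ true))

  reached-source : ∀ j → reached j s ≡ true
  reached-source zero = ==-refl s
  reached-source (suc j) rewrite reached-source j = refl

  reached-step : ∀ j x y → Adj G x y → reached j x ≡ true → reached (suc j) y ≡ true
  reached-step j x y x~y rx with reached j y
  ... | true  = refl
  ... | false = dec-true (any? (λ w → reached j w ∧ adj G w y ≟ᵇ true)) (x , cong₂ _∧_ rx x~y)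

  reached⇒walk : ∀ j z → reached j z ≡ true → Σ ℕ λ ℓ → ℓ ≤ j × Walk′ G ℓ s z
  reached⇒walk zero z r = 0 , z≤n , trivialWalk (sym (==⇒≡ r))
  reached⇒walk (suc j) z r with reached j z in rz | any? (λ w → reached j w ∧ adj G w z ≟ᵇ true)
  ... | true  | _ = let (ℓ , ℓ≤j , W) = reached⇒walk j z rz in ℓ , m≤n⇒m≤1+n ℓ≤j , W
  ... | false | yes (w , rw∧w~z) with reached j w in rw
  ...   | true = let (ℓ , ℓ≤j , W) = reached⇒walk j w rw in suc ℓ , s≤s ℓ≤j , snoc W rw∧w~z

  unreached : ℕ → Fin n → ℕ
  unreached zero    z = 0
  unreached (suc j) z = unreached j z + bit (not (reached j z))

  unreached-source : ∀ j → unreached j s ≡ 0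
  unreached-source zero = refl
  unreached-source (suc j) rewrite unreached-source j | reached-source j = refl

  unreached-≤ : ∀ j z → unreached j z ≤ j
  unreached-≤ zero z = z≤n
  unreached-≤ (suc j) z with reached j z
  ... | true  = ≤-trans (≤-reflexive (+-identityʳ _)) (m≤n⇒m≤1+n (unreached-≤ j z))
  ... | false = ≤-trans (≤-reflexive (+-comm _ 1)) (s≤s (unreached-≤ j z))

  bit≤1 : ∀ b → bit b ≤ 1
  bit≤1 true = ≤-refl
  bit≤1 false = z≤n

  -- Once x is reached, so is its neighbour y a round later; so y lags x by at most one round.
  unreached-step : ∀ j x y → Adj G x y → unreached (suc j) y ≤ suc (unreached j x)
  unreached-step zero x y x~y = bit≤1 _
  unreached-step (suc j) x y x~y with reached j x in rx
  ... | true rewrite reached-step j x y x~y rx | +-identityʳ (unreached j x) =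
    ≤-trans (≤-reflexive (+-identityʳ _)) (unreached-step j x y x~y)
  ... | false = +-mono-≤ (unreached-step j x y x~y) (bit≤1 _)

  unreached-far : ∀ D z → DistAtLeast′ G s z D → ∀ j → j ≤ D → unreached j z ≡ j
  unreached-far D z far zero _ = refl
  unreached-far D z far (suc j) j<D with reached j z in rz
  ... | false rewrite unreached-far D z far j (<⇒≤ j<D) = +-comm j 1
  ... | true  = let (ℓ , ℓ≤j , W) = reached⇒walk j z rz in ⊥-elim (far ℓ (≤-<-trans ℓ≤j j<D) W)

  module _ (D : ℕ) where

    potential : Fin n → ℕ
    potential = unreached D

    potential-lipschitz : Lipschitz G potential
    potential-lipschitz x y x~y = ≤-trans (m≤m+n _ _) (unreached-step D x y x~y)

    potential-source : potential s ≡ 0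
    potential-source = unreached-source D

    potential-≤ : ∀ z → potential z ≤ D
    potential-≤ = unreached-≤ D

    potential-far : ∀ z → DistAtLeast′ G s z D → potential z ≡ D
    potential-far z far = unreached-far D z far D ≤-refl

-- Deleting an edge

joins : ∀ {n} → Fin n → Fin n → Fin n → Fin n → Bool
joins p q x y = (x == p ∧ y == q) ∨ (x == q ∧ y == p)

joins-sym : ∀ {n} (p q x y : Fin n) → joins p q x y ≡ joins p q y x
joins-sym p q x y rewrite ∧-comm (x == p) (y == q) | ∧-comm (x == q) (y == p) = ∨-comm (y == q ∧ x == p) (y == p ∧ x == q)

removeEdge : ∀ {n} → Graph n → Fin n → Fin n → Graph n
removeEdge G p q = record
  { adj    = λ x y → adj G x y ∧ not (joins p q x y)
  ; sym    = λ x y → cong₂ _∧_ (adj-sym G x y) (cong not (joins-sym p q x y))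
  ; irrefl = λ v → cong (_∧ not (joins p q v v)) (adj-irrefl G v) }

module _ {n} (G : Graph n) (p q : Fin n) where

  removeEdge-⊆ : ∀ {x y} → Adj (removeEdge G p q) x y → Adj G x y
  removeEdge-⊆ {x} {y} e with adj G x y
  ... | true = refl

  removeEdge-removes : adj (removeEdge G p q) p q ≡ false
  removeEdge-removes rewrite ==-refl p | ==-refl q = ∧-zeroʳ (adj G p q)

  removeEdge-keeps : ∀ {x y} → Adj G x y → (x ≡ p → y ≢ q) → (y ≡ p → x ≢ q) → Adj (removeEdge G p q) x y
  removeEdge-keeps {x} {y} x~y not-pq not-qp rewrite x~y = cong not joins-false
    where
    joins-false : joins p q x y ≡ false
    joins-false with x == p in xp | y == q in yq | x == q in xq | y == p in yp
    ... | true  | true  | _     | _     = ⊥-elim (not-pq (==⇒≡ xp) (==⇒≡ yq))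
    ... | _     | _     | true  | true  = ⊥-elim (not-qp (==⇒≡ yp) (==⇒≡ xq))
    ... | false | _     | false | _     = refl
    ... | false | _     | true  | false = refl
    ... | true  | false | false | _     = refl
    ... | true  | false | true  | false = refl

  lipschitz-removeEdge : ∀ {h} → Lipschitz G h → Lipschitz (removeEdge G p q) h
  lipschitz-removeEdge lip x y x~y = lip x y (removeEdge-⊆ x~y)

  distAtLeast′-removeEdge : ∀ {x y D} → DistAtLeast′ G x y D → DistAtLeast′ (removeEdge G p q) x y D
  distAtLeast′-removeEdge far ℓ ℓ<D W = far ℓ ℓ<D (mapWalk removeEdge-⊆ W)

  girth-removeEdge : ∀ {B} → GirthAtLeast G B → GirthAtLeast (removeEdge G p q) B
  girth-removeEdge girth L C = girth L (mapCycle C id (λ s → removeEdge-⊆ (Cycle.step C s)) (λ _ _ e → e))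

  deg-removeEdge : Adj G p q → ∀ x → deg (removeEdge G p q) x + bit (x == p) + bit (x == q) ≡ deg G x
  deg-removeEdge p~q x = begin
    deg (removeEdge G p q) x + bit (x == p) + bit (x == q)
      ≡⟨ cong₂ (λ a b → a + b + bit (x == q)) (deg≡∑ (removeEdge G p q) x) (sym (∑-point-∧ (x == p) q)) ⟩
    ∑ kept + ∑ toQ + bit (x == q)
      ≡⟨ cong (∑ kept + ∑ toQ +_) (sym (∑-point-∧ (x == q) p)) ⟩
    ∑ kept + ∑ toQ + ∑ toP
      ≡⟨ cong (_+ ∑ toP) (sym (∑-distrib-+ kept toQ)) ⟩
    ∑ (λ w → kept w + toQ w) + ∑ toP
      ≡⟨ sym (∑-distrib-+ (λ w → kept w + toQ w) toP) ⟩
    ∑ (λ w → kept w + toQ w + toP w)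
      ≡⟨ sum-cong-≗ (λ w → bit-partition (adj G x w) _ _ (toQ⇒adj w) (toP⇒adj w) (toQ⇒¬toP w)) ⟩
    ∑ (λ w → bit (adj G x w))
      ≡⟨ sym (deg≡∑ G x) ⟩
    deg G x ∎
    where
    open ≡-Reasoning
    kept toQ toP : Fin n → ℕ
    kept w = bit (adj G x w ∧ not (joins p q x w))
    toQ w = bit (x == p ∧ w == q)
    toP w = bit (x == q ∧ w == p)
    toQ⇒adj : ∀ w → (x == p ∧ w == q) ≡ true → Adj G x w
    toQ⇒adj w e = subst₂ (Adj G) (sym (==⇒≡ {i = x} (proj₁ (∧-true e)))) (sym (==⇒≡ {i = w} (proj₂ (∧-true {x == p} e)))) p~q
    toP⇒adj : ∀ w → (x == q ∧ w == p) ≡ true → Adj G x w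
    toP⇒adj w e = subst₂ (Adj G) (sym (==⇒≡ {i = x} (proj₁ (∧-true e)))) (sym (==⇒≡ {i = w} (proj₂ (∧-true {x == q} e))))
                    (trans (adj-sym G q p) p~q)
    toQ⇒¬toP : ∀ w → (x == p ∧ w == q) ≡ true → (x == q ∧ w == p) ≡ false
    toQ⇒¬toP w e = cong (_∧ (w == p)) (subst (λ v → (v == q) ≡ false) (sym (==⇒≡ {i = x} {j = p} (proj₁ (∧-true e))))
                                                (≢⇒==-false (adj⇒≢ G p~q)))

module _ {n} {G : Graph n} where

  IsPath : ∀ {ℓ x y} → Walk′ G ℓ x y → Set
  IsPath {ℓ} W = ∀ i j → i < j → j ≤ ℓ → Walk′.w W i ≢ Walk′.w W j

  shortcut : ∀ {ℓ x y} (W : Walk′ G ℓ x y) i e → i + e ≤ ℓ → Walk′.w W i ≡ Walk′.w W (i + e) → Walk′ G (ℓ ∸ e) x y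
  shortcut {ℓ} {x} {y} W i e i+e≤ℓ loop = record { w = w ∘ skip ; start = start′ ; end = end′ ; steps = steps′ }
    where
    open Walk′ W
    skip : ℕ → ℕ
    skip t with t <? i
    ... | yes _ = t
    ... | no  _ = t + e
    e≤ℓ : e ≤ ℓ
    e≤ℓ = ≤-trans (m≤n+m e i) i+e≤ℓ
    i≤ℓ∸e : i ≤ ℓ ∸ e
    i≤ℓ∸e = ≤-trans (≤-reflexive (sym (m+n∸n≡m i e))) (∸-monoˡ-≤ e i+e≤ℓ)
    start′ : w (skip 0) ≡ x
    start′ with 0 <? i
    ... | yes _ = start
    ... | no 0≮i rewrite n≤0⇒n≡0 (≮⇒≥ 0≮i) = trans (sym loop) start
    end′ : w (skip (ℓ ∸ e)) ≡ y
    end′ with ℓ ∸ e <? i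
    ... | yes ℓ∸e<i = ⊥-elim (<⇒≱ ℓ∸e<i i≤ℓ∸e)
    ... | no  _ = trans (cong w (m∸n+n≡m e≤ℓ)) end
    steps′ : ∀ t → t < ℓ ∸ e → Adj G (w (skip t)) (w (skip (suc t)))
    steps′ t t<ℓ∸e with t <? i | suc t <? i
    ... | yes _   | yes t+1<i = steps t (≤-trans (<⇒≤ t+1<i) (≤-trans i≤ℓ∸e (m∸n≤m ℓ e)))
    ... | yes t<i | no  t+1≮i = subst (Adj G (w t)) (trans (cong w t+1≡i) (trans loop (cong (λ j → w (j + e)) (sym t+1≡i))))
                                  (steps t (≤-trans t<i (≤-trans i≤ℓ∸e (m∸n≤m ℓ e))))
      where
      t+1≡i : suc t ≡ i
      t+1≡i = ≤-antisym t<i (≮⇒≥ t+1≮i)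
    ... | no  t≮i | yes t+1<i = ⊥-elim (t≮i (<-trans (n<1+n t) t+1<i))
    ... | no  _   | no  _     = steps (t + e) (≤-trans (+-monoˡ-≤ e t<ℓ∸e) (≤-reflexive (m∸n+n≡m e≤ℓ)))

  repeats? : (w : ℕ → Fin n) → ∀ ℓ → Dec (∃ λ j → j < suc ℓ × ∃ λ i → i < j × w i ≡ w j)
  repeats? w ℓ = anyUpTo? (λ j → anyUpTo? (λ i → w i ≟ᶠ w j) j) (suc ℓ)

  ToPath : ℕ → Set
  ToPath ℓ = ∀ {x y} → Walk′ G ℓ x y → Σ ℕ λ ℓ′ → ℓ′ ≤ ℓ × Σ (Walk′ G ℓ′ x y) IsPath

  toPath : ∀ ℓ → ToPath ℓ
  toPath = <-rec ToPath shorten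
    where
    shorten : ∀ ℓ → (∀ {ℓ′} → ℓ′ < ℓ → ToPath ℓ′) → ToPath ℓ
    shorten ℓ rec W with repeats? (Walk′.w W) ℓ
    ... | no none = ℓ , ≤-refl , W , λ i j i<j j≤ℓ wi≡wj → none (j , s≤s j≤ℓ , i , i<j , wi≡wj)
    ... | yes (j , j<1+ℓ , i , i<j , wi≡wj) =
      let (ℓ′ , ℓ′≤ , P , isPath) = rec ℓ∸e<ℓ (shortcut W i e (≤-trans (≤-reflexive i+e≡j) (s≤s⁻¹ j<1+ℓ)) loop)
      in ℓ′ , ≤-trans ℓ′≤ (<⇒≤ ℓ∸e<ℓ) , P , isPath
      where
      e = proj₁ (m≤n⇒∃[o]m+o≡n (<⇒≤ i<j))
      i+e≡j : i + e ≡ j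
      i+e≡j = proj₂ (m≤n⇒∃[o]m+o≡n (<⇒≤ i<j))
      loop : Walk′.w W i ≡ Walk′.w W (i + e)
      loop = trans wi≡wj (cong (Walk′.w W) (sym i+e≡j))
      0<e : 0 < e
      0<e = n≢0⇒n>0 (λ e≡0 → <⇒≢ i<j (trans (sym (+-identityʳ i)) (trans (cong (i +_) (sym e≡0)) i+e≡j)))
      ℓ∸e<ℓ : ℓ ∸ e < ℓ
      ℓ∸e<ℓ = ∸-monoʳ-< 0<e (≤-trans (m≤n+m e i) (≤-trans (≤-reflexive i+e≡j) (s≤s⁻¹ j<1+ℓ)))

  path+edge⇒cycle : ∀ {ℓ x y} (P : Walk′ G ℓ x y) → IsPath P → 2 ≤ ℓ → Adj G y x → HasCycle G (suc ℓ)
  path+edge⇒cycle {ℓ} P isPath 2≤ℓ y~x = s≤s 2≤ℓ , (λ i → w (toℕ i)) , injective , steps′ , close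
    where
    open Walk′ P
    injective : ∀ {i j : Fin (suc ℓ)} → w (toℕ i) ≡ w (toℕ j) → i ≡ j
    injective {i} {j} e with <-cmp (toℕ i) (toℕ j)
    ... | tri≈ _ i≡j _ = toℕ-injective i≡j
    ... | tri< i<j _ _ = ⊥-elim (isPath _ _ i<j (s≤s⁻¹ (toℕ<n j)) e)
    ... | tri> _ _ j<i = ⊥-elim (isPath _ _ j<i (s≤s⁻¹ (toℕ<n i)) (sym e))
    steps′ : ∀ (i : Fin ℓ) → Adj G (w (toℕ (inject₁ i))) (w (suc (toℕ i)))
    steps′ i = subst (λ s → Adj G (w s) (w (suc (toℕ i)))) (sym (toℕ-inject₁ i)) (steps (toℕ i) (toℕ<n i))
    close : Adj G (w (toℕ (fromℕ ℓ))) (w 0)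
    close = subst₂ (Adj G) (sym (trans (cong w (toℕ-fromℕ ℓ)) end)) (sym start) y~x

module _ {n} (G : Graph n) {B} (girth : GirthAtLeast G B) {p q} (p~q : Adj G p q) where

  -- A walk from p to q avoiding the edge pq closes up with that edge into a cycle.
  removeEdge-walk≥ : ∀ {ℓ} → Walk′ (removeEdge G p q) ℓ p q → B ≤ suc ℓ
  removeEdge-walk≥ {ℓ} W with toPath ℓ W
  ... | zero , _ , P , _ = ⊥-elim (adj⇒≢ G p~q (trans (sym (Walk′.start P)) (Walk′.end P)))
  ... | suc zero , _ , P , _ =
    ⊥-elim (false≢true (trans (sym (removeEdge-removes G p q))
                              (subst₂ (Adj (removeEdge G p q)) (Walk′.start P) (Walk′.end P) (Walk′.steps P 0 ≤-refl))))
  ... | suc (suc m) , ℓ′≤ℓ , P , isPath =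
    ≤-trans (girth _ (hasCycle⇒cycle _ (path+edge⇒cycle {G = G} (mapWalk (removeEdge-⊆ G p q) P) isPath (s≤s (s≤s z≤n))
                                                          (trans (adj-sym G q p) p~q))))
            (s≤s ℓ′≤ℓ)

  removeEdge-distAtLeast′ : ∀ {D} → D < B → DistAtLeast′ (removeEdge G p q) p q D
  removeEdge-distAtLeast′ D<B ℓ ℓ<D W = <-irrefl refl (≤-trans (s≤s ℓ<D) (≤-trans D<B (removeEdge-walk≥ W)))

extra-neighbour : ∀ {n} (G : Graph n) v → deg G v ≡ 3 → ∀ p q → Σ (Fin n) λ w → Adj G v w × w ≢ p × w ≢ q
extra-neighbour {n} G v deg≡3 p q with any? (λ w → (adj G v w ≟ᵇ true) ×-dec ¬? (w ≟ᶠ p) ×-dec ¬? (w ≟ᶠ q))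
... | yes found = found
... | no none = ⊥-elim (<⇒≱ (s≤s (s≤s (s≤s z≤n))) (begin
  3                                     ≡⟨ sym deg≡3 ⟩
  deg G v                               ≡⟨ deg≡∑ G v ⟩
  ∑ (λ w → bit (adj G v w))             ≤⟨ ∑-mono-≤ only-p-or-q ⟩
  ∑ (λ w → bit (w == p) + bit (w == q)) ≡⟨ ∑-distrib-+ (λ w → bit (w == p)) (λ w → bit (w == q)) ⟩
  ∑ (λ w → bit (w == p)) + ∑ (λ w → bit (w == q)) ≡⟨ cong₂ _+_ (∑-point p) (∑-point q) ⟩
  2                                     ∎))
  where
  open ≤-Reasoning
  only-p-or-q : ∀ w → bit (adj G v w) ≤ bit (w == p) + bit (w == q)
  only-p-or-q w with adj G v w in v~w | w ≟ᶠ p | w ≟ᶠ q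
  ... | false | _        | _        = z≤n
  ... | true  | yes refl | _        = ≤-trans (≤-reflexive (cong bit (sym (==-refl w)))) (m≤m+n _ _)
  ... | true  | no _     | yes refl = ≤-trans (≤-reflexive (cong bit (sym (==-refl w)))) (m≤n+m _ _)
  ... | true  | no w≢p   | no w≢q   = ⊥-elim (none (w , v~w , w≢p , w≢q))

-- Gluing two graphs at two vertices

pattern inner i = suc (suc i)

-- Vertices of two graphs on 2 + m and 2 + r vertices glued along their first two vertices.
data Part (m r : ℕ) : Set where
  end₀ end₁ : Part m r
  left      : Fin m → Part m r
  right     : Fin r → Part m r

module Parts (m r : ℕ) where

  fromSplit : Fin m ⊎ Fin r → Part m r
  fromSplit (inj₁ i) = left i
  fromSplit (inj₂ j) = right j

  part : Fin (suc (suc (m + r))) → Part m r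
  part 0F = end₀
  part 1F = end₁
  part (inner x) = fromSplit (splitAt m x)

  unpart : Part m r → Fin (suc (suc (m + r)))
  unpart end₀ = 0F
  unpart end₁ = 1F
  unpart (left i) = inner (i ↑ˡ r)
  unpart (right j) = inner (m ↑ʳ j)

  part-unpart : ∀ u → part (unpart u) ≡ u
  part-unpart end₀ = refl
  part-unpart end₁ = refl
  part-unpart (left i) = cong fromSplit (splitAt-↑ˡ m i r)
  part-unpart (right j) = cong fromSplit (splitAt-↑ʳ m r j)

  unpart-part : ∀ x → unpart (part x) ≡ x
  unpart-part 0F = refl
  unpart-part 1F = refl
  unpart-part (inner x) = trans (unsplit (splitAt m x)) (cong inner (join-splitAt m r x))
    where
    unsplit : ∀ s → unpart (fromSplit s) ≡ inner (join m r s)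
    unsplit (inj₁ i) = refl
    unsplit (inj₂ j) = refl

  part-injective : ∀ {x y} → part x ≡ part y → x ≡ y
  part-injective {x} {y} e = trans (sym (unpart-part x)) (trans (cong unpart e) (unpart-part y))

  data IsLeft : Part m r → Set where
    left : ∀ i → IsLeft (left i)

  data IsRight : Part m r → Set where
    right : ∀ j → IsRight (right j)

  isLeft? : Decidable IsLeft
  isLeft? end₀ = no λ ()
  isLeft? end₁ = no λ ()
  isLeft? (left i) = yes (left i)
  isLeft? (right j) = no λ ()

  isRight? : Decidable IsRight
  isRight? end₀ = no λ ()
  isRight? end₁ = no λ ()
  isRight? (left i) = no λ ()
  isRight? (right j) = yes (right j)

run-end : ∀ {P : ℕ → Set} → Decidable P → ∀ i d → P i → ¬ P (i + d) → Σ ℕ λ s → i ≤ s × s < i + d × P s × ¬ P (suc s)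
run-end {P} P? i zero Pi ¬Pi+0 = ⊥-elim (¬Pi+0 (subst P (sym (+-identityʳ i)) Pi))
run-end {P} P? i (suc d) Pi ¬Pi+1+d with P? (i + d)
... | yes Pi+d = i + d , m≤m+n i d , ≤-reflexive (sym (+-suc i d)) , Pi+d , subst (λ t → ¬ P t) (+-suc i d) ¬Pi+1+d
... | no ¬Pi+d = let (s , i≤s , s<i+d , Ps , ¬Ps+1) = run-end P? i d Pi ¬Pi+d in
                 s , i≤s , ≤-trans s<i+d (≤-trans (n≤1+n _) (≤-reflexive (sym (+-suc i d)))) , Ps , ¬Ps+1

module Glue {m r} (GL : Graph (suc (suc m))) (GR : Graph (suc (suc r))) (X : Fin m → Fin r → Bool)
            (GL-0≁1 : adj GL 0F 1F ≡ false) (GR-0≁1 : adj GR 0F 1F ≡ false) where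

  open Parts m r public

  adjᴾ : Part m r → Part m r → Bool
  adjᴾ end₀      end₀       = false
  adjᴾ end₀      end₁       = false
  adjᴾ end₁      end₀       = false
  adjᴾ end₁      end₁       = false
  adjᴾ end₀      (left i)   = adj GL 0F (inner i)
  adjᴾ end₀      (right j)  = adj GR 0F (inner j)
  adjᴾ end₁      (left i)   = adj GL 1F (inner i)
  adjᴾ end₁      (right j)  = adj GR 1F (inner j)
  adjᴾ (left i)  end₀       = adj GL (inner i) 0F
  adjᴾ (left i)  end₁       = adj GL (inner i) 1F
  adjᴾ (right j) end₀       = adj GR (inner j) 0F
  adjᴾ (right j) end₁       = adj GR (inner j) 1F
  adjᴾ (left i)  (left i′)  = adj GL (inner i) (inner i′)
  adjᴾ (right j) (right j′) = adj GR (inner j) (inner j′)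
  adjᴾ (left i)  (right j)  = X i j
  adjᴾ (right j) (left i)   = X i j

  adjᴾ-sym : ∀ u v → adjᴾ u v ≡ adjᴾ v u
  adjᴾ-sym end₀      end₀      = refl
  adjᴾ-sym end₀      end₁      = refl
  adjᴾ-sym end₁      end₀      = refl
  adjᴾ-sym end₁      end₁      = refl
  adjᴾ-sym end₀      (left i)  = adj-sym GL _ _
  adjᴾ-sym end₀      (right j) = adj-sym GR _ _
  adjᴾ-sym end₁      (left i)  = adj-sym GL _ _
  adjᴾ-sym end₁      (right j) = adj-sym GR _ _
  adjᴾ-sym (left i)  end₀      = adj-sym GL _ _
  adjᴾ-sym (left i)  end₁      = adj-sym GL _ _
  adjᴾ-sym (right j) end₀      = adj-sym GR _ _
  adjᴾ-sym (right j) end₁      = adj-sym GR _ _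
  adjᴾ-sym (left i)  (left _)  = adj-sym GL _ _
  adjᴾ-sym (right j) (right _) = adj-sym GR _ _
  adjᴾ-sym (left i)  (right j) = refl
  adjᴾ-sym (right j) (left i)  = refl

  adjᴾ-irrefl : ∀ u → adjᴾ u u ≡ false
  adjᴾ-irrefl end₀ = refl
  adjᴾ-irrefl end₁ = refl
  adjᴾ-irrefl (left i) = adj-irrefl GL _
  adjᴾ-irrefl (right j) = adj-irrefl GR _

  glued : Graph (suc (suc (m + r)))
  glued = record
    { adj    = λ x y → adjᴾ (part x) (part y)
    ; sym    = λ x y → adjᴾ-sym (part x) (part y)
    ; irrefl = λ x → adjᴾ-irrefl (part x) }

  deg-by-part : ∀ x → deg glued x ≡ bit (adjᴾ (part x) end₀) + bit (adjᴾ (part x) end₁)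
                                    + (∑ (λ i → bit (adjᴾ (part x) (left i))) + ∑ (λ j → bit (adjᴾ (part x) (right j))))
  deg-by-part x = begin
    deg glued x
      ≡⟨ deg≡∑ glued x ⟩
    a₀ + (a₁ + ∑ (λ z → bit (adjᴾ u (fromSplit (splitAt m z)))))
      ≡⟨ sym (+-assoc a₀ a₁ _) ⟩
    a₀ + a₁ + ∑ (λ z → bit (adjᴾ u (fromSplit (splitAt m z))))
      ≡⟨ cong (a₀ + a₁ +_) (∑-↑ m (λ z → bit (adjᴾ u (fromSplit (splitAt m z))))) ⟩
    a₀ + a₁ + (∑ (λ i → bit (adjᴾ u (fromSplit (splitAt m (i ↑ˡ r))))) + ∑ (λ j → bit (adjᴾ u (fromSplit (splitAt m (m ↑ʳ j))))))
      ≡⟨ cong (λ s → a₀ + a₁ + s) (cong₂ _+_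
           (sum-cong-≗ (λ i → cong (λ v → bit (adjᴾ u (fromSplit v))) (splitAt-↑ˡ m i r)))
           (sum-cong-≗ (λ j → cong (λ v → bit (adjᴾ u (fromSplit v))) (splitAt-↑ʳ m r j)))) ⟩
    a₀ + a₁ + (∑ (λ i → bit (adjᴾ u (left i))) + ∑ (λ j → bit (adjᴾ u (right j)))) ∎
    where
    open ≡-Reasoning
    u = part x
    a₀ = bit (adjᴾ u end₀)
    a₁ = bit (adjᴾ u end₁)

  deg-by-ends : ∀ {k} (G : Graph (suc (suc k))) x → deg G x ≡ bit (adj G x 0F) + bit (adj G x 1F) + ∑ (λ i → bit (adj G x (inner i)))
  deg-by-ends G x = trans (deg≡∑ G x) (sym (+-assoc (bit (adj G x 0F)) _ _))

  deg-glued₀ : deg glued 0F ≡ deg GL 0F + deg GR 0F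
  deg-glued₀ rewrite deg-by-part 0F | deg-by-ends GL 0F | deg-by-ends GR 0F
                 | adj-irrefl GL 0F | adj-irrefl GR 0F | GL-0≁1 | GR-0≁1 = refl

  deg-glued₁ : deg glued 1F ≡ deg GL 1F + deg GR 1F
  deg-glued₁ rewrite deg-by-part 1F | deg-by-ends GL 1F | deg-by-ends GR 1F
                 | adj-irrefl GL 1F | adj-irrefl GR 1F | adj-sym GL 1F 0F | adj-sym GR 1F 0F | GL-0≁1 | GR-0≁1 = refl

  deg-glued-left : ∀ i → deg glued (inner (i ↑ˡ r)) ≡ deg GL (inner i) + ∑ (λ j → bit (X i j))
  deg-glued-left i rewrite deg-by-part (inner (i ↑ˡ r)) | splitAt-↑ˡ m i r | deg-by-ends GL (inner i) =
    sym (+-assoc (bit (adj GL (inner i) 0F) + bit (adj GL (inner i) 1F)) _ _)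

  deg-glued-right : ∀ j → deg glued (inner (m ↑ʳ j)) ≡ deg GR (inner j) + ∑ (λ i → bit (X i j))
  deg-glued-right j rewrite deg-by-part (inner (m ↑ʳ j)) | splitAt-↑ʳ m r j | deg-by-ends GR (inner j) =
    trans (cong (a +_) (+-comm (∑ (λ i → bit (X i j))) _)) (sym (+-assoc a _ _))
    where a = bit (adj GR (inner j) 0F) + bit (adj GR (inner j) 1F)

  ofL : Fin (suc (suc m)) → Part m r
  ofL 0F = end₀
  ofL 1F = end₁
  ofL (inner i) = left i

  ofR : Fin (suc (suc r)) → Part m r
  ofR 0F = end₀
  ofR 1F = end₁
  ofR (inner j) = right j

  toL : Part m r → Fin (suc (suc m))
  toL end₀ = 0F
  toL end₁ = 1F
  toL (left i) = inner i
  toL (right _) = 0F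

  toR : Part m r → Fin (suc (suc r))
  toR end₀ = 0F
  toR end₁ = 1F
  toR (left _) = 0F
  toR (right j) = inner j

  toL-ofL : ∀ z → toL (ofL z) ≡ z
  toL-ofL 0F = refl
  toL-ofL 1F = refl
  toL-ofL (inner i) = refl

  toR-ofR : ∀ z → toR (ofR z) ≡ z
  toR-ofR 0F = refl
  toR-ofR 1F = refl
  toR-ofR (inner j) = refl

  ofL-toL : ∀ u → ¬ IsRight u → ofL (toL u) ≡ u
  ofL-toL end₀ _ = refl
  ofL-toL end₁ _ = refl
  ofL-toL (left i) _ = refl
  ofL-toL (right j) ¬right = ⊥-elim (¬right (right j))

  ofR-toR : ∀ u → ¬ IsLeft u → ofR (toR u) ≡ u
  ofR-toR end₀ _ = refl
  ofR-toR end₁ _ = refl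
  ofR-toR (right j) _ = refl
  ofR-toR (left i) ¬left = ⊥-elim (¬left (left i))

  adjᴾ-ofL : ∀ z z′ → adjᴾ (ofL z) (ofL z′) ≡ adj GL z z′
  adjᴾ-ofL 0F        0F         = sym (adj-irrefl GL 0F)
  adjᴾ-ofL 0F        1F         = sym GL-0≁1
  adjᴾ-ofL 1F        0F         = sym (trans (adj-sym GL 1F 0F) GL-0≁1)
  adjᴾ-ofL 1F        1F         = sym (adj-irrefl GL 1F)
  adjᴾ-ofL 0F        (inner _)  = refl
  adjᴾ-ofL 1F        (inner _)  = refl
  adjᴾ-ofL (inner _) 0F         = refl
  adjᴾ-ofL (inner _) 1F         = refl
  adjᴾ-ofL (inner _) (inner _)  = refl

  adjᴾ-ofR : ∀ z z′ → adjᴾ (ofR z) (ofR z′) ≡ adj GR z z′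
  adjᴾ-ofR 0F        0F         = sym (adj-irrefl GR 0F)
  adjᴾ-ofR 0F        1F         = sym GR-0≁1
  adjᴾ-ofR 1F        0F         = sym (trans (adj-sym GR 1F 0F) GR-0≁1)
  adjᴾ-ofR 1F        1F         = sym (adj-irrefl GR 1F)
  adjᴾ-ofR 0F        (inner _)  = refl
  adjᴾ-ofR 1F        (inner _)  = refl
  adjᴾ-ofR (inner _) 0F         = refl
  adjᴾ-ofR (inner _) 1F         = refl
  adjᴾ-ofR (inner _) (inner _)  = refl

  embedL : Fin (suc (suc m)) → Fin (suc (suc (m + r)))
  embedL = unpart ∘ ofL

  embedR : Fin (suc (suc r)) → Fin (suc (suc (m + r)))
  embedR = unpart ∘ ofR

  adj-embedL : ∀ z z′ → adj glued (embedL z) (embedL z′) ≡ adj GL z z′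
  adj-embedL z z′ rewrite part-unpart (ofL z) | part-unpart (ofL z′) = adjᴾ-ofL z z′

  adj-embedR : ∀ z z′ → adj glued (embedR z) (embedR z′) ≡ adj GR z z′
  adj-embedR z z′ rewrite part-unpart (ofR z) | part-unpart (ofR z′) = adjᴾ-ofR z z′

  embedL-injective : ∀ {z z′} → embedL z ≡ embedL z′ → z ≡ z′
  embedL-injective {z} {z′} e =
    trans (sym (toL-ofL z)) (trans (cong toL (trans (sym (part-unpart (ofL z))) (trans (cong part e) (part-unpart (ofL z′))))) (toL-ofL z′))

  embedR-injective : ∀ {z z′} → embedR z ≡ embedR z′ → z ≡ z′
  embedR-injective {z} {z′} e =
    trans (sym (toR-ofR z)) (trans (cong toR (trans (sym (part-unpart (ofR z))) (trans (cong part e) (part-unpart (ofR z′))))) (toR-ofR z′))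

  cycle-embedL : ∀ {L} → Cycle GL L → Cycle glued L
  cycle-embedL C = mapCycle C embedL (λ s → trans (adj-embedL _ _) (Cycle.step C s)) (λ _ _ → embedL-injective)

  cycle-embedR : ∀ {L} → Cycle GR L → Cycle glued L
  cycle-embedR C = mapCycle C embedR (λ s → trans (adj-embedR _ _) (Cycle.step C s)) (λ _ _ → embedR-injective)

  cycle-inL : ∀ {L} (C : Cycle glued L) → (∀ s → ¬ IsRight (part (Cycle.c C s))) → Cycle GL L
  cycle-inL C ¬right = mapCycle C (toL ∘ part)
    (λ s → trans (sym (adjᴾ-ofL _ _)) (trans (cong₂ adjᴾ (ofL-toL _ (¬right s)) (ofL-toL _ (¬right (suc s)))) (Cycle.step C s)))
    (λ s t e → part-injective (trans (sym (ofL-toL _ (¬right s))) (trans (cong ofL e) (ofL-toL _ (¬right t)))))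

  cycle-inR : ∀ {L} (C : Cycle glued L) → (∀ s → ¬ IsLeft (part (Cycle.c C s))) → Cycle GR L
  cycle-inR C ¬left = mapCycle C (toR ∘ part)
    (λ s → trans (sym (adjᴾ-ofR _ _)) (trans (cong₂ adjᴾ (ofR-toR _ (¬left s)) (ofR-toR _ (¬left (suc s)))) (Cycle.step C s)))
    (λ s t e → part-injective (trans (sym (ofR-toR _ (¬left s))) (trans (cong ofR e) (ofR-toR _ (¬left t)))))

  module GlueLipschitz (hL : Fin (suc (suc m)) → ℕ) (hR : Fin (suc (suc r)) → ℕ)
                       (h₀ : hL 0F ≡ hR 0F) (h₁ : hL 1F ≡ hR 1F) (lipL : Lipschitz GL hL) (lipR : Lipschitz GR hR)
                       (lipX : ∀ i j → X i j ≡ true → hR (inner j) ≤ suc (hL (inner i)) × hL (inner i) ≤ suc (hR (inner j))) where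

    hᴾ : Part m r → ℕ
    hᴾ end₀ = hL 0F
    hᴾ end₁ = hL 1F
    hᴾ (left i) = hL (inner i)
    hᴾ (right j) = hR (inner j)

    lipᴾ : ∀ u v → adjᴾ u v ≡ true → hᴾ v ≤ suc (hᴾ u)
    lipᴾ end₀      (left i)  a = lipL 0F (inner i) a
    lipᴾ end₀      (right j) a = subst (λ t → hR (inner j) ≤ suc t) (sym h₀) (lipR 0F (inner j) a)
    lipᴾ end₁      (left i)  a = lipL 1F (inner i) a
    lipᴾ end₁      (right j) a = subst (λ t → hR (inner j) ≤ suc t) (sym h₁) (lipR 1F (inner j) a)
    lipᴾ (left i)  end₀      a = lipL (inner i) 0F a
    lipᴾ (left i)  end₁      a = lipL (inner i) 1F a
    lipᴾ (right j) end₀      a = subst (_≤ suc (hR (inner j))) (sym h₀) (lipR (inner j) 0F a)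
    lipᴾ (right j) end₁      a = subst (_≤ suc (hR (inner j))) (sym h₁) (lipR (inner j) 1F a)
    lipᴾ (left i)  (left _)  a = lipL _ _ a
    lipᴾ (right j) (right _) a = lipR _ _ a
    lipᴾ (left i)  (right j) a = proj₁ (lipX i j a)
    lipᴾ (right j) (left i)  a = proj₂ (lipX i j a)

    hᴳ : Fin (suc (suc (m + r))) → ℕ
    hᴳ = hᴾ ∘ part

    glued-lipschitz : Lipschitz glued hᴳ
    glued-lipschitz x y = lipᴾ (part x) (part y)

  IsEnd : Part m r → Set
  IsEnd v = v ≡ end₀ ⊎ v ≡ end₁

  LeavesLeft : Fin m → Part m r → Set
  LeavesLeft i v = IsEnd v ⊎ Σ (Fin r) λ j → v ≡ right j × X i j ≡ true

  LeavesRight : Fin r → Part m r → Set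
  LeavesRight j v = IsEnd v ⊎ Σ (Fin m) λ i → v ≡ left i × X i j ≡ true

  leavesLeft : ∀ i v → adjᴾ (left i) v ≡ true → ¬ IsLeft v → LeavesLeft i v
  leavesLeft i end₀ _ _ = inj₁ (inj₁ refl)
  leavesLeft i end₁ _ _ = inj₁ (inj₂ refl)
  leavesLeft i (left i′) _ ¬left = ⊥-elim (¬left (left i′))
  leavesLeft i (right j) x _ = inj₂ (j , refl , x)

  leavesRight : ∀ j v → adjᴾ (right j) v ≡ true → ¬ IsRight v → LeavesRight j v
  leavesRight j end₀ _ _ = inj₁ (inj₁ refl)
  leavesRight j end₁ _ _ = inj₁ (inj₂ refl)
  leavesRight j (right j′) _ ¬right = ⊥-elim (¬right (right j′))
  leavesRight j (left i) x _ = inj₂ (i , refl , x)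

  left⇒¬right : ∀ {u} → IsLeft u → ¬ IsRight u
  left⇒¬right (left i) ()

  -- A cycle meeting both sides leaves the left side at some position s and the right side at a later s′;
  -- each exit goes to an end or along a cross edge, and every combination is either impossible or long.
  module Girth (B : ℕ) (girthL : GirthAtLeast GL B) (girthR : GirthAtLeast GR B)
    (X-unique : ∀ {i j i′ j′} → X i j ≡ true → X i′ j′ ≡ true → i ≡ i′ × j ≡ j′)
    (through-ends : ∀ {L} (C : Cycle glued L) {p q} → part (Cycle.c C p) ≡ end₀ → part (Cycle.c C q) ≡ end₁ → B ≤ L)
    (through-X : ∀ {L} (C : Cycle glued L) {p q q′ i j} → X i j ≡ true → IsEnd (part (Cycle.c C p)) →
                 part (Cycle.c C q) ≡ left i → part (Cycle.c C q′) ≡ right j → B ≤ L) where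

    module _ {L} (C : Cycle glued L) where
      open Cycle C

      OnLeft OnRight : ℕ → Set
      OnLeft k = IsLeft (part (c k))
      OnRight k = IsRight (part (c k))

      stepᴾ : ∀ s → adjᴾ (part (c s)) (part (c (suc s))) ≡ true
      stepᴾ = step

      exitLeft : ∀ s → OnLeft s → ¬ OnLeft (suc s) → Σ (Fin m) λ i → part (c s) ≡ left i × LeavesLeft i (part (c (suc s)))
      exitLeft s onLeft ¬onLeft with part (c s) | onLeft | stepᴾ s
      ... | _ | left i | a = i , refl , leavesLeft i _ a ¬onLeft

      exitRight : ∀ s → OnRight s → ¬ OnRight (suc s) → Σ (Fin r) λ j → part (c s) ≡ right j × LeavesRight j (part (c (suc s)))
      exitRight s onRight ¬onRight with part (c s) | onRight | stepᴾ s
      ... | _ | right j | a = j , refl , leavesRight j _ a ¬onRight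

      repeat : ∀ {p q} → p < q → q < p + L → part (c p) ≡ part (c q) → B ≤ L
      repeat p<q q<p+L e = ⊥-elim (distinct _ _ p<q q<p+L (part-injective e))

      two-exits : ∀ {s s′} → s < s′ → s′ < s + L → OnLeft s → ¬ OnLeft (suc s) → OnRight s′ → ¬ OnRight (suc s′) → B ≤ L
      two-exits {s} {s′} s<s′ s′<s+L Ls ¬Ls+1 Rs′ ¬Rs′+1
        with exitLeft s Ls ¬Ls+1 | exitRight s′ Rs′ ¬Rs′+1
      ... | i , cs , inj₁ (inj₁ e₀) | j , cs′ , inj₁ (inj₁ e₀′) = repeat (s≤s s<s′) (s≤s s′<s+L) (trans e₀ (sym e₀′))
      ... | i , cs , inj₁ (inj₂ e₁) | j , cs′ , inj₁ (inj₂ e₁′) = repeat (s≤s s<s′) (s≤s s′<s+L) (trans e₁ (sym e₁′))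
      ... | i , cs , inj₁ (inj₁ e₀) | j , cs′ , inj₁ (inj₂ e₁′) = through-ends C e₀ e₁′
      ... | i , cs , inj₁ (inj₂ e₁) | j , cs′ , inj₁ (inj₁ e₀′) = through-ends C e₀′ e₁
      ... | i , cs , inj₁ end       | j , cs′ , inj₂ (i′ , e , x) = through-X C x end e cs′
      ... | i , cs , inj₂ (j′ , e , x) | j , cs′ , inj₁ end    = through-X C x end cs e
      -- Both exits use the one cross edge, in opposite directions: c (s + 1) = c s′ and c s = c (s′ + 1).
      ... | i , cs , inj₂ (j′ , e , x) | j , cs′ , inj₂ (i′ , e′ , x′)
        with X-unique x x′ | <-cmp (suc s) s′
      ... | refl , refl | tri< s+1<s′ _ _ = repeat s+1<s′ (≤-trans s′<s+L (n≤1+n _)) (trans e (sym cs′))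
      ... | refl , refl | tri> _ _ s′<s+1 = ⊥-elim (<⇒≱ s<s′ (s≤s⁻¹ s′<s+1))
      ... | refl , refl | tri≈ _ refl _ =
        repeat (≤-trans (n<1+n s) (n≤1+n _)) (subst (_< s + L) (+-comm s 2) (+-monoʳ-< s 3≤L)) (trans cs (sym e′))

      crossing : ∀ {i j} → i < j → j < i + L → OnLeft i → OnRight j → B ≤ L
      crossing {i} {j} i<j j<i+L Li Rj =
        two-exits (<-≤-trans s<j (proj₁ (proj₂ exitR))) (≤-trans s′<i+L (+-monoˡ-≤ L i≤s)) Ls ¬Ls+1 Rs′ ¬Rs′+1
        where
        d₁ = proj₁ (m≤n⇒∃[o]m+o≡n (<⇒≤ i<j))
        i+d₁≡j = proj₂ (m≤n⇒∃[o]m+o≡n (<⇒≤ i<j))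
        d₂ = proj₁ (m≤n⇒∃[o]m+o≡n (<⇒≤ j<i+L))
        j+d₂≡i+L = proj₂ (m≤n⇒∃[o]m+o≡n (<⇒≤ j<i+L))
        exitL = run-end (λ k → isLeft? (part (c k))) i d₁ Li
                  (λ L′ → left⇒¬right L′ (subst OnRight (sym i+d₁≡j) Rj))
        exitR = run-end (λ k → isRight? (part (c k))) j d₂ Rj
                  (λ R′ → left⇒¬right (subst (λ v → IsLeft (part v)) (sym (trans (cong c j+d₂≡i+L) (period i))) Li) R′)
        s = proj₁ exitL
        i≤s = proj₁ (proj₂ exitL)
        s<j : s < j
        s<j = subst (s <_) i+d₁≡j (proj₁ (proj₂ (proj₂ exitL)))
        Ls = proj₁ (proj₂ (proj₂ (proj₂ exitL)))
        ¬Ls+1 = proj₂ (proj₂ (proj₂ (proj₂ exitL)))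
        s′ = proj₁ exitR
        s′<i+L : s′ < i + L
        s′<i+L = subst (s′ <_) j+d₂≡i+L (proj₁ (proj₂ (proj₂ exitR)))
        Rs′ = proj₁ (proj₂ (proj₂ (proj₂ exitR)))
        ¬Rs′+1 = proj₂ (proj₂ (proj₂ (proj₂ exitR)))

      meets-both : ∀ {i j} → i < L → j < L → OnLeft i → OnRight j → B ≤ L
      meets-both {i} {j} i<L j<L Li Rj with <-cmp i j
      ... | tri< i<j _ _ = crossing i<j (≤-trans j<L (m≤n+m L i)) Li Rj
      ... | tri≈ _ refl _ = ⊥-elim (left⇒¬right Li Rj)
      ... | tri> _ _ j<i = crossing (≤-trans i<L (m≤n+m L j)) (+-monoˡ-< L j<i) Li
                             (subst (λ v → IsRight (part v)) (sym (period j)) Rj)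

      nowhere : ∀ {P : Part m r → Set} → ¬ (∃ λ k → k < L × P (part (c k))) → ∀ s → ¬ P (part (c s))
      nowhere {P} none s Ps = none (s % L , m%n<n s L , subst (λ v → P (part v)) (c-% s) Ps)

    glued-girth : GirthAtLeast glued B
    glued-girth L C with anyUpTo? (λ k → isRight? (part (Cycle.c C k))) L | anyUpTo? (λ k → isLeft? (part (Cycle.c C k))) L
    ... | no ¬right | _ = girthL L (cycle-inL C (nowhere C {IsRight} ¬right))
    ... | _ | no ¬left = girthR L (cycle-inR C (nowhere C {IsLeft} ¬left))
    ... | yes (j , j<L , Rj) | yes (i , i<L , Li) = meets-both C i<L j<L Li Rj

-- Gadgets

ThreeMGraph : ℕ → ℕ → ℕ → Set
ThreeMGraph n m g = Σ (Graph n) λ H → HasGirth H g × (∀ v → deg H v ≡ 3 ⊎ deg H v ≡ m)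

inner-cases : ∀ {m r} (P : Fin (suc (suc (m + r))) → Set) →
              (∀ i → P (inner (i ↑ˡ r))) → (∀ j → P (inner (m ↑ʳ j))) → ∀ z → P (inner z)
inner-cases {m} {r} P onL onR z with splitAt m z in e
... | inj₁ i = subst (λ w → P (inner w)) (trans (cong (join m r) (sym e)) (join-splitAt m r z)) (onL i)
... | inj₂ j = subst (λ w → P (inner w)) (trans (cong (join m r) (sym e)) (join-splitAt m r z)) (onR j)

module Gadgets (D : ℕ) (2≤D : 2 ≤ D) where

  0<D : 0 < D
  0<D = ≤-trans (s≤s z≤n) 2≤D

  -- The potential makes every cycle through both ends have length at least 2D (twice-rise≤length),
  -- which is what survives gluing gadgets at their ends.
  record Gadget (r d : ℕ) : Set where
    field
      graph      : Graph (suc (suc r))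
      deg-end₀   : deg graph 0F ≡ d
      deg-end₁   : deg graph 1F ≡ d
      deg-inner  : ∀ j → deg graph (inner j) ≡ 3
      girth      : GirthAtLeast graph (D + D)
      h          : Fin (suc (suc r)) → ℕ
      lipschitz  : Lipschitz graph h
      h-end₀     : h 0F ≡ 0
      h-end₁     : h 1F ≡ D

    ends-nonadjacent : adj graph 0F 1F ≡ false
    ends-nonadjacent with adj graph 0F 1F in e
    ... | false = refl
    ... | true  = ⊥-elim (≤⇒≯ (subst₂ (λ a b → a ≤ suc b) h-end₁ h-end₀ (lipschitz 0F 1F e)) 2≤D)

  open Gadget

  cast : ∀ {r r′ d d′} → r ≡ r′ → d ≡ d′ → Gadget r d → Gadget r′ d′
  cast refl refl Γ = Γ

  cast-cycle : ∀ {r r′ d d′ L} (e₁ : r ≡ r′) (e₂ : d ≡ d′) (Γ : Gadget r d) → Cycle (graph Γ) L → Cycle (graph (cast e₁ e₂ Γ)) L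
  cast-cycle refl refl Γ C = C

  module Glued {m r d e} (Γ : Gadget m d) (Δ : Gadget r e) where
    open Glue (graph Γ) (graph Δ) (λ _ _ → false) (ends-nonadjacent Γ) (ends-nonadjacent Δ) public
    open GlueLipschitz (h Γ) (h Δ) (trans (h-end₀ Γ) (sym (h-end₀ Δ))) (trans (h-end₁ Γ) (sym (h-end₁ Δ)))
                       (lipschitz Γ) (lipschitz Δ) (λ _ _ ()) public
    open Girth (D + D) (girth Γ) (girth Δ) (λ ())
      (λ C e₀ e₁ → twice-rise≤length glued-lipschitz C 0<D (trans (cong hᴾ e₀) (h-end₀ Γ)) (trans (cong hᴾ e₁) (h-end₁ Γ)))
      (λ C ()) public

  _⊕_ : ∀ {m r d e} → Gadget m d → Gadget r e → Gadget (m + r) (d + e)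
  _⊕_ {m} {r} Γ Δ = record
    { graph     = glued
    ; deg-end₀  = trans deg-glued₀ (cong₂ _+_ (Gadget.deg-end₀ Γ) (Gadget.deg-end₀ Δ))
    ; deg-end₁  = trans deg-glued₁ (cong₂ _+_ (Gadget.deg-end₁ Γ) (Gadget.deg-end₁ Δ))
    ; deg-inner = inner-cases (λ x → deg glued x ≡ 3)
        (λ i → trans (deg-glued-left i) (cong₂ _+_ (deg-inner Γ i) (∑-zero {r} _ (λ _ → refl))))
        (λ j → trans (deg-glued-right j) (cong₂ _+_ (deg-inner Δ j) (∑-zero {m} _ (λ _ → refl))))
    ; girth     = glued-girth
    ; h         = hᴳ
    ; lipschitz = glued-lipschitz
    ; h-end₀    = h-end₀ Γ
    ; h-end₁    = h-end₁ Γ }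
    where open Glued Γ Δ

  cycle-⊕ˡ : ∀ {m r d e L} (Γ : Gadget m d) (Δ : Gadget r e) → Cycle (graph Γ) L → Cycle (graph (Γ ⊕ Δ)) L
  cycle-⊕ˡ Γ Δ = Glued.cycle-embedL Γ Δ

  cycle-⊕ʳ : ∀ {m r d e L} (Γ : Gadget m d) (Δ : Gadget r e) → Cycle (graph Δ) L → Cycle (graph (Γ ⊕ Δ)) L
  cycle-⊕ʳ Γ Δ = Glued.cycle-embedR Γ Δ

  realise : ∀ {s d N d′} (Γ : Gadget s d) → Cycle (graph Γ) (D + D) → suc (suc s) ≡ N → d ≡ d′ → ThreeMGraph N d′ (D + D)
  realise Γ C refl refl = graph Γ , (cycle⇒hasCycle (D + D) C , no-shorter) , degrees
    where
    no-shorter : ∀ ℓ → ℓ < D + D → ¬ HasCycle (graph Γ) ℓ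
    no-shorter ℓ ℓ<2D hc = <⇒≱ ℓ<2D (girth Γ ℓ (hasCycle⇒cycle ℓ hc))
    degrees : ∀ v → deg (graph Γ) v ≡ 3 ⊎ deg (graph Γ) v ≡ _
    degrees 0F = inj₂ (deg-end₀ Γ)
    degrees 1F = inj₂ (deg-end₁ Γ)
    degrees (inner j) = inj₁ (deg-inner Γ j)

-- The gadgets built from G

module Construction (D : ℕ) (2≤D : 2 ≤ D) {r : ℕ} (G : Graph (suc (suc r))) (cubic : ∀ x → deg G x ≡ 3)
                    (girth : GirthAtLeast G (D + D)) (far : DistAtLeast′ G 0F 1F D) where
  open Gadgets D 2≤D
  open CappedDistance

  base : Gadget r 3
  base = record
    { graph     = G
    ; deg-end₀  = cubic 0F
    ; deg-end₁  = cubic 1F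
    ; deg-inner = λ j → cubic (inner j)
    ; girth     = girth
    ; h         = potential G 0F D
    ; lipschitz = potential-lipschitz G 0F D
    ; h-end₀    = potential-source G 0F D
    ; h-end₁    = potential-far G 0F D 1F far }

  0≁1 : adj G 0F 1F ≡ false
  0≁1 = Gadget.ends-nonadjacent base

  inner-neighbour : ∀ (e : Fin (suc (suc r))) → adj G e 0F ≡ false → adj G e 1F ≡ false → ∀ p q →
                    Σ (Fin r) λ i → Adj G e (inner i) × inner i ≢ p × inner i ≢ q
  inner-neighbour e e≁0 e≁1 p q with extra-neighbour G e (cubic e) p q
  ... | 0F , e~w , _ = ⊥-elim (false≢true (trans (sym e≁0) e~w))
  ... | 1F , e~w , _ = ⊥-elim (false≢true (trans (sym e≁1) e~w))
  ... | inner i , e~w , w≢p , w≢q = i , e~w , w≢p , w≢q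

  inner-neighbour₀ : ∀ p q → Σ (Fin r) λ i → Adj G 0F (inner i) × inner i ≢ p × inner i ≢ q
  inner-neighbour₀ = inner-neighbour 0F (adj-irrefl G 0F) 0≁1

  inner-neighbour₁ : ∀ p q → Σ (Fin r) λ i → Adj G 1F (inner i) × inner i ≢ p × inner i ≢ q
  inner-neighbour₁ = inner-neighbour 1F (trans (adj-sym G 1F 0F) 0≁1) (adj-irrefl G 1F)

  D∸2<D+D : D ∸ 2 < D + D
  D∸2<D+D = ≤-<-trans (m∸n≤m D 2) (m<m+n D (≤-trans (s≤s z≤n) 2≤D))

  D<D+D : D < D + D
  D<D+D = m<m+n D (≤-trans (s≤s z≤n) 2≤D)

  -- Delete an edge 0y of G and hang new ends from its endpoints: two ends of degree 1.
  module Pendant where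
    y : Fin (suc (suc r))
    y = inner (proj₁ (inner-neighbour₀ 0F 0F))

    0~y : Adj G 0F y
    0~y = proj₁ (proj₂ (inner-neighbour₀ 0F 0F))

    Q : Graph (suc (suc r))
    Q = removeEdge G 0F y

    adjᵖ : Fin (suc (suc (suc (suc r)))) → Fin (suc (suc (suc (suc r)))) → Bool
    adjᵖ 0F        0F         = false
    adjᵖ 0F        1F         = false
    adjᵖ 0F        (inner z)  = z == 0F
    adjᵖ 1F        0F         = false
    adjᵖ 1F        1F         = false
    adjᵖ 1F        (inner z)  = z == y
    adjᵖ (inner z) 0F         = z == 0F
    adjᵖ (inner z) 1F         = z == y
    adjᵖ (inner z) (inner z′) = adj Q z z′

    adjᵖ-sym : ∀ x w → adjᵖ x w ≡ adjᵖ w x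
    adjᵖ-sym 0F        0F         = refl
    adjᵖ-sym 0F        1F         = refl
    adjᵖ-sym 0F        (inner z)  = refl
    adjᵖ-sym 1F        0F         = refl
    adjᵖ-sym 1F        1F         = refl
    adjᵖ-sym 1F        (inner z)  = refl
    adjᵖ-sym (inner z) 0F         = refl
    adjᵖ-sym (inner z) 1F         = refl
    adjᵖ-sym (inner z) (inner z′) = adj-sym Q z z′

    adjᵖ-irrefl : ∀ x → adjᵖ x x ≡ false
    adjᵖ-irrefl 0F = refl
    adjᵖ-irrefl 1F = refl
    adjᵖ-irrefl (inner z) = adj-irrefl Q z

    graphᵖ : Graph (suc (suc (suc (suc r))))
    graphᵖ = record { adj = adjᵖ ; sym = adjᵖ-sym ; irrefl = adjᵖ-irrefl }

    deg-innerᵖ : ∀ z → deg graphᵖ (inner z) ≡ 3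
    deg-innerᵖ z = begin
      deg graphᵖ (inner z)                                    ≡⟨ deg≡∑ graphᵖ (inner z) ⟩
      bit (z == 0F) + (bit (z == y) + ∑ (λ w → bit (adj Q z w))) ≡⟨ cong (λ d → bit (z == 0F) + (bit (z == y) + d)) (sym (deg≡∑ Q z)) ⟩
      bit (z == 0F) + (bit (z == y) + deg Q z)                 ≡⟨ rotate (bit (z == 0F)) (bit (z == y)) (deg Q z) ⟩
      deg Q z + bit (z == 0F) + bit (z == y)                   ≡⟨ deg-removeEdge G 0F y 0~y z ⟩
      deg G z                                                  ≡⟨ cubic z ⟩
      3                                                        ∎
      where
      open ≡-Reasoning
      rotate : ∀ a b c → a + (b + c) ≡ c + a + b
      rotate = solve-∀

    hq : Fin (suc (suc r)) → ℕ
    hq = potential Q 0F (D ∸ 2)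

    hq-y : hq y ≡ D ∸ 2
    hq-y = potential-far Q 0F (D ∸ 2) y (removeEdge-distAtLeast′ G girth 0~y D∸2<D+D)

    hᵖ : Fin (suc (suc (suc (suc r)))) → ℕ
    hᵖ 0F = 0
    hᵖ 1F = D
    hᵖ (inner z) = suc (hq z)

    lipschitzᵖ : Lipschitz graphᵖ hᵖ
    lipschitzᵖ 0F        (inner z)  a rewrite ==⇒≡ {i = z} a | potential-source Q 0F (D ∸ 2) = ≤-refl
    lipschitzᵖ 1F        (inner z)  a = s≤s (≤-trans (potential-≤ Q 0F (D ∸ 2) z) (m∸n≤m D 2))
    lipschitzᵖ (inner z) 0F         a = z≤n
    lipschitzᵖ (inner z) 1F         a rewrite ==⇒≡ {i = z} a | hq-y = ≤-reflexive (sym (2+[D∸2]≡D 2≤D))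
      where
      2+[D∸2]≡D : ∀ {d} → 2 ≤ d → suc (suc (d ∸ 2)) ≡ d
      2+[D∸2]≡D (s≤s (s≤s z≤n)) = refl
    lipschitzᵖ (inner z) (inner z′) a = s≤s (potential-lipschitz Q 0F (D ∸ 2) z z′ a)

    only-neighbour₀ : ∀ u → Adj graphᵖ 0F u → u ≡ inner 0F
    only-neighbour₀ (inner z) a = cong inner (==⇒≡ a)

    only-neighbour₁ : ∀ u → Adj graphᵖ 1F u → u ≡ inner y
    only-neighbour₁ (inner z) a = cong inner (==⇒≡ a)

    strip : Fin (suc (suc (suc (suc r)))) → Fin (suc (suc r))
    strip (inner z) = z
    strip _ = 0F

    -- The new ends are leaves, so every cycle lies in Q ⊆ G.
    girthᵖ : GirthAtLeast graphᵖ (D + D)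
    girthᵖ L C = girth L (mapCycle C strip step′ injective)
      where
      open Cycle C
      is-inner : ∀ s → Σ (Fin (suc (suc r))) λ z → c s ≡ inner z
      is-inner s with c s in e
      ... | 0F = ⊥-elim (leaf-off-cycle C only-neighbour₀ s e)
      ... | 1F = ⊥-elim (leaf-off-cycle C only-neighbour₁ s e)
      ... | inner z = z , refl
      step′ : ∀ s → Adj G (strip (c s)) (strip (c (suc s)))
      step′ s with is-inner s | is-inner (suc s) | step s
      ... | z , e | z′ , e′ | a rewrite e | e′ = removeEdge-⊆ G 0F y a
      injective : ∀ s t → strip (c s) ≡ strip (c t) → c s ≡ c t
      injective s t eq with is-inner s | is-inner t
      ... | z , e | z′ , e′ rewrite e | e′ = cong inner eq

  pendant : Gadget (suc (suc r)) 1
  pendant = record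
    { graph     = graphᵖ
    ; deg-end₀  = trans (deg≡∑ graphᵖ 0F) (∑-point {suc (suc r)} 0F)
    ; deg-end₁  = trans (deg≡∑ graphᵖ 1F) (∑-point y)
    ; deg-inner = deg-innerᵖ
    ; girth     = girthᵖ
    ; h         = hᵖ
    ; lipschitz = lipschitzᵖ
    ; h-end₀    = refl
    ; h-end₁    = refl }
    where open Pendant

  -- Two copies of G glued at their ends, the edge 1y removed from the left copy and 0x from the right one,
  -- and the cross edge y x added: two ends of degree 5.
  module Double (cycle : Cycle G (D + D)) where
    p q : Fin (suc (suc r))
    p = proj₁ (cycle-neighbours cycle 1F)
    q = proj₁ (proj₂ (cycle-neighbours cycle 1F))

    xᵢ yᵢ : Fin r
    xᵢ = proj₁ (inner-neighbour₀ 0F 0F)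
    yᵢ = proj₁ (inner-neighbour₁ p q)

    x y : Fin (suc (suc r))
    x = inner xᵢ
    y = inner yᵢ

    0~x : Adj G 0F x
    0~x = proj₁ (proj₂ (inner-neighbour₀ 0F 0F))

    1~y : Adj G 1F y
    1~y = proj₁ (proj₂ (inner-neighbour₁ p q))

    QL QR : Graph (suc (suc r))
    QL = removeEdge G 1F y
    QR = removeEdge G 0F x

    X : Fin r → Fin r → Bool
    X i j = (i == yᵢ) ∧ (j == xᵢ)

    X⇒y : ∀ i j → X i j ≡ true → i ≡ yᵢ
    X⇒y i j e = ==⇒≡ (proj₁ (∧-true e))

    X⇒x : ∀ i j → X i j ≡ true → j ≡ xᵢ
    X⇒x i j e = ==⇒≡ (proj₂ (∧-true {i == yᵢ} e))

    QL-0≁1 : adj QL 0F 1F ≡ false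
    QL-0≁1 rewrite 0≁1 = refl

    QR-0≁1 : adj QR 0F 1F ≡ false
    QR-0≁1 rewrite 0≁1 = refl

    open Glue QL QR X QL-0≁1 QR-0≁1

    deg-QL : ∀ z → deg QL z + bit (z == 1F) + bit (z == y) ≡ 3
    deg-QL z = trans (deg-removeEdge G 1F y 1~y z) (cubic z)

    deg-QR : ∀ z → deg QR z + bit (z == 0F) + bit (z == x) ≡ 3
    deg-QR z = trans (deg-removeEdge G 0F x 0~x z) (cubic z)

    untouched : ∀ {a} → a + 0 + 0 ≡ 3 → a ≡ 3
    untouched e = trans (sym (trans (+-identityʳ _) (+-identityʳ _))) e

    touched : ∀ {a} → a + 1 + 0 ≡ 3 → a ≡ 2
    touched e = +-cancelʳ-≡ 1 _ 2 (trans (sym (+-identityʳ _)) e)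

    deg-double₀ : deg glued 0F ≡ 5
    deg-double₀ = trans deg-glued₀ (cong₂ _+_ (untouched (deg-QL 0F)) (touched (deg-QR 0F)))

    deg-double₁ : deg glued 1F ≡ 5
    deg-double₁ = trans deg-glued₁ (cong₂ _+_ (touched (deg-QL 1F)) (untouched (deg-QR 1F)))

    deg-double-left : ∀ i → deg glued (inner (i ↑ˡ r)) ≡ 3
    deg-double-left i = begin
      deg glued (inner (i ↑ˡ r))               ≡⟨ deg-glued-left i ⟩
      deg QL (inner i) + ∑ (λ j → bit (X i j)) ≡⟨ cong (deg QL (inner i) +_) (∑-point-∧ (i == yᵢ) xᵢ) ⟩
      deg QL (inner i) + bit (i == yᵢ)         ≡⟨ cong (_+ bit (i == yᵢ)) (sym (+-identityʳ _)) ⟩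
      deg QL (inner i) + 0 + bit (i == yᵢ)     ≡⟨ deg-QL (inner i) ⟩
      3                                        ∎
      where open ≡-Reasoning

    deg-double-right : ∀ j → deg glued (inner (r ↑ʳ j)) ≡ 3
    deg-double-right j = begin
      deg glued (inner (r ↑ʳ j))               ≡⟨ deg-glued-right j ⟩
      deg QR (inner j) + ∑ (λ i → bit (X i j)) ≡⟨ cong (deg QR (inner j) +_) (sum-cong-≗ (λ i → cong bit (∧-comm (i == yᵢ) (j == xᵢ)))) ⟩
      deg QR (inner j) + ∑ (λ i → bit ((j == xᵢ) ∧ (i == yᵢ))) ≡⟨ cong (deg QR (inner j) +_) (∑-point-∧ (j == xᵢ) yᵢ) ⟩
      deg QR (inner j) + bit (j == xᵢ)         ≡⟨ cong (_+ bit (j == xᵢ)) (sym (+-identityʳ _)) ⟩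
      deg QR (inner j) + 0 + bit (j == xᵢ)     ≡⟨ deg-QR (inner j) ⟩
      3                                        ∎
      where open ≡-Reasoning

    balanced : ∀ {a b} → a ≤ D → D ≤ suc a → b ≡ D → b ≤ suc a × a ≤ suc b
    balanced a≤D D≤1+a refl = D≤1+a , m≤n⇒m≤1+n a≤D

    hG hQR : Fin (suc (suc r)) → ℕ
    hG = potential G 0F D
    hQR = potential QR 0F D

    D≤1+hG-y : D ≤ suc (hG y)
    D≤1+hG-y = subst (_≤ suc (hG y)) (potential-far G 0F D 1F far)
                 (potential-lipschitz G 0F D y 1F (trans (adj-sym G y 1F) 1~y))

    hQR-x : hQR x ≡ D
    hQR-x = potential-far QR 0F D x (removeEdge-distAtLeast′ G girth 0~x D<D+D)

    open GlueLipschitz hG hQR (trans (potential-source G 0F D) (sym (potential-source QR 0F D)))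
           (trans (potential-far G 0F D 1F far) (sym (potential-far QR 0F D 1F (distAtLeast′-removeEdge G 0F x far))))
           (lipschitz-removeEdge G 1F y (potential-lipschitz G 0F D)) (potential-lipschitz QR 0F D)
           (λ i j e → subst₂ (λ i′ j′ → hQR (inner j′) ≤ suc (hG (inner i′)) × hG (inner i′) ≤ suc (hQR (inner j′)))
                        (sym (X⇒y i j e)) (sym (X⇒x i j e)) (balanced (potential-≤ G 0F D y) D≤1+hG-y hQR-x))
      renaming (hᴾ to h₀ᴾ; hᴳ to h₀; glued-lipschitz to lipschitz₀)

    far₁₀ : DistAtLeast′ G 1F 0F D
    far₁₀ ℓ ℓ<D W = <⇒≱ ℓ<D (subst₂ (λ a b → a ≤ b + ℓ) (potential-far G 0F D 1F far) (potential-source G 0F D)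
                                  (walk-rise≤length (potential-lipschitz G 0F D) W))

    hG′ hQL′ : Fin (suc (suc r)) → ℕ
    hG′ = potential G 1F D
    hQL′ = potential QL 1F D

    D≤1+hG′-x : D ≤ suc (hG′ x)
    D≤1+hG′-x = subst (_≤ suc (hG′ x)) (potential-far G 1F D 0F far₁₀)
                  (potential-lipschitz G 1F D x 0F (trans (adj-sym G x 0F) 0~x))

    hQL′-y : hQL′ y ≡ D
    hQL′-y = potential-far QL 1F D y (removeEdge-distAtLeast′ G girth 1~y D<D+D)

    open GlueLipschitz hQL′ hG′
           (trans (potential-far QL 1F D 0F (distAtLeast′-removeEdge G 1F y far₁₀)) (sym (potential-far G 1F D 0F far₁₀)))
           (trans (potential-source QL 1F D) (sym (potential-source G 1F D)))
           (potential-lipschitz QL 1F D) (lipschitz-removeEdge G 0F x (potential-lipschitz G 1F D))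
           (λ i j e → subst₂ (λ i′ j′ → hG′ (inner j′) ≤ suc (hQL′ (inner i′)) × hQL′ (inner i′) ≤ suc (hG′ (inner j′)))
                        (sym (X⇒y i j e)) (sym (X⇒x i j e)) (swap (balanced (potential-≤ G 1F D x) D≤1+hG′-x hQL′-y)))
      renaming (hᴾ to h₁ᴾ; hᴳ to h₁; glued-lipschitz to lipschitz₁)

    X-unique : ∀ {i j i′ j′} → X i j ≡ true → X i′ j′ ≡ true → i ≡ i′ × j ≡ j′
    X-unique {i} {j} {i′} {j′} e e′ = trans (X⇒y i j e) (sym (X⇒y i′ j′ e′)) , trans (X⇒x i j e) (sym (X⇒x i′ j′ e′))

    through-ends : ∀ {L} (C : Cycle glued L) {p q} → part (Cycle.c C p) ≡ end₀ → part (Cycle.c C q) ≡ end₁ → D + D ≤ L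
    through-ends C e₀ e₁ = twice-rise≤length lipschitz₀ C 0<D (trans (cong h₀ᴾ e₀) (potential-source G 0F D))
                                                           (trans (cong h₀ᴾ e₁) (potential-far G 0F D 1F far))

    -- A cycle through an end and the cross edge climbs from potential 0 to D: from end 0 to x, or from end 1 to y
    -- for the potential measured from end 1.
    through-X : ∀ {L} (C : Cycle glued L) {p q q′ i j} → X i j ≡ true → IsEnd (part (Cycle.c C p)) →
                part (Cycle.c C q) ≡ left i → part (Cycle.c C q′) ≡ right j → D + D ≤ L
    through-X C {i = i} {j} x (inj₁ e₀) _ eR =
      twice-rise≤length lipschitz₀ C 0<D (trans (cong h₀ᴾ e₀) (potential-source G 0F D))
                                          (trans (cong h₀ᴾ eR) (trans (cong (λ k → hQR (inner k)) (X⇒x i j x)) hQR-x))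
    through-X C {i = i} {j} x (inj₂ e₁) eL _ =
      twice-rise≤length lipschitz₁ C 0<D (trans (cong h₁ᴾ e₁) (potential-source QL 1F D))
                                          (trans (cong h₁ᴾ eL) (trans (cong (λ k → hQL′ (inner k)) (X⇒y i j x)) hQL′-y))

    open Girth (D + D) (girth-removeEdge G 1F y girth) (girth-removeEdge G 0F x girth) X-unique through-ends through-X

    -- y was chosen off the cycle's two edges at 1, so the cycle survives in the left copy.
    cycle-QL : Cycle QL (D + D)
    cycle-QL = mapCycle cycle id step′ (λ _ _ e → e)
      where
      open Cycle cycle
      neighbours = proj₂ (proj₂ (cycle-neighbours cycle 1F))
      step′ : ∀ s → Adj QL (c s) (c (suc s))
      step′ s = removeEdge-keeps G 1F y (step s)
        (λ cs≡1 cs+1≡y → proj₁ (proj₂ (proj₂ (inner-neighbour₁ p q))) (trans (sym cs+1≡y) (proj₁ neighbours s cs≡1)))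
        (λ cs+1≡1 cs≡y → proj₂ (proj₂ (proj₂ (inner-neighbour₁ p q))) (trans (sym cs≡y) (proj₂ neighbours s cs+1≡1)))

    double : Gadget (r + r) 5
    double = record
      { graph     = glued
      ; deg-end₀  = deg-double₀
      ; deg-end₁  = deg-double₁
      ; deg-inner = inner-cases (λ z → deg glued z ≡ 3) deg-double-left deg-double-right
      ; girth     = glued-girth
      ; h         = h₀
      ; lipschitz = lipschitz₀
      ; h-end₀    = potential-source G 0F D
      ; h-end₁    = potential-far G 0F D 1F far }

    double-cycle : Cycle (Gadget.graph double) (D + D)
    double-cycle = cycle-embedL cycle-QL

  +-suc-* : ∀ a k b → a + k * b + b ≡ a + suc k * b
  +-suc-* = solve-∀

  copies : ∀ k {s d} → Gadget s d → Gadget (s + k * r) (d + k * 3)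
  copies zero    {s} {d} Γ = cast (sym (+-identityʳ s)) (sym (+-identityʳ d)) Γ
  copies (suc k) {s} {d} Γ = cast (+-suc-* s k r) (+-suc-* d k 3) (copies k Γ ⊕ base)

  copies-cycle : ∀ k {s d L} (Γ : Gadget s d) → Cycle (Gadget.graph Γ) L → Cycle (Gadget.graph (copies k Γ)) L
  copies-cycle zero    {s} {d} Γ C = cast-cycle (sym (+-identityʳ s)) (sym (+-identityʳ d)) Γ C
  copies-cycle (suc k) {s} {d} Γ C = cast-cycle (+-suc-* s k r) (+-suc-* d k 3) (copies k Γ ⊕ base) (cycle-⊕ˡ (copies k Γ) base (copies-cycle k Γ C))

  copies-base-cycle : ∀ k {s d} (Γ : Gadget s d) → Cycle G (D + D) → Cycle (Gadget.graph (copies (suc k) Γ)) (D + D)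
  copies-base-cycle k {s} {d} Γ C = cast-cycle (+-suc-* s k r) (+-suc-* d k 3) (copies k Γ ⊕ base) (cycle-⊕ʳ (copies k Γ) base C)

  construction : Cycle G (D + D) → (k : ℕ) (t : Fin 3) → 1 ≤ k → ThreeMGraph (k * r + extra t (suc (suc r))) (3 * k + toℕ t) (D + D)
  construction C (suc k) 0F _ = realise (copies k base) (copies-cycle k base C) (size₀ k r) (degree₀ k)
    where
    size₀ : ∀ k r → suc (suc (r + k * r)) ≡ suc k * r + 2
    size₀ = solve-∀
    degree₀ : ∀ k → 3 + k * 3 ≡ 3 * suc k + 0
    degree₀ = solve-∀
  construction C (suc k) 1F _ = realise (copies (suc k) pendant) (copies-base-cycle k pendant C) (size₁ k r) (degree₁ k)
    where
    size₁ : ∀ k r → suc (suc (suc (suc r) + suc k * r)) ≡ suc k * r + (suc (suc r) + 2)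
    size₁ = solve-∀
    degree₁ : ∀ k → 1 + suc k * 3 ≡ 3 * suc k + 1
    degree₁ = solve-∀
  construction C (suc k) 2F _ = realise (copies k (Double.double C)) (copies-cycle k _ (Double.double-cycle C)) (size₂ k r) (degree₂ k)
    where
    size₂ : ∀ k r → suc (suc (r + r + k * r)) ≡ suc k * r + suc (suc r)
    size₂ = solve-∀
    degree₂ : ∀ k → 5 + k * 3 ≡ 3 * suc k + 2
    degree₂ = solve-∀

-- Relabelling and the theorem

module _ {n} (G : Graph n) (π : Permutation′ n) where

  relabel : Graph n
  relabel = record
    { adj    = λ a b → adj G (π ⟨$⟩ʳ a) (π ⟨$⟩ʳ b)
    ; sym    = λ a b → adj-sym G (π ⟨$⟩ʳ a) (π ⟨$⟩ʳ b)
    ; irrefl = λ a → adj-irrefl G (π ⟨$⟩ʳ a) }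

  deg-relabel : ∀ a → deg relabel a ≡ deg G (π ⟨$⟩ʳ a)
  deg-relabel a = trans (deg≡∑ relabel a) (sym (trans (deg≡∑ G (π ⟨$⟩ʳ a)) (∑-permute (λ w → bit (adj G (π ⟨$⟩ʳ a) w)) π)))

  girth-relabel : ∀ {g} → (∀ ℓ → ℓ < g → ¬ HasCycle G ℓ) → GirthAtLeast relabel g
  girth-relabel no-short L C = ≮⇒≥ (λ L<g → no-short L L<g (cycle⇒hasCycle L
    (mapCycle C (π ⟨$⟩ʳ_) (Cycle.step C) (λ _ _ e → trans (sym (inverseˡ π)) (trans (cong (π ⟨$⟩ˡ_) e) (inverseˡ π))))))

  cycle-relabel : ∀ {L} → Cycle G L → Cycle relabel L
  cycle-relabel C = mapCycle C (π ⟨$⟩ˡ_) (λ s → subst₂ (Adj G) (sym (inverseʳ π)) (sym (inverseʳ π)) (Cycle.step C s))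
                      (λ _ _ e → trans (sym (inverseʳ π)) (trans (cong (π ⟨$⟩ʳ_) e) (inverseʳ π)))

  distAtLeast′-relabel : ∀ {a b D} → DistAtLeast′ G (π ⟨$⟩ʳ a) (π ⟨$⟩ʳ b) D → DistAtLeast′ relabel a b D
  distAtLeast′-relabel far ℓ ℓ<D W = far ℓ ℓ<D (record
    { w = λ s → π ⟨$⟩ʳ w s ; start = cong (π ⟨$⟩ʳ_) start ; end = cong (π ⟨$⟩ʳ_) end ; steps = steps })
    where open Walk′ W

ends-to : ∀ {r} {u v : Fin (suc (suc r))} → u ≢ v → Σ (Permutation′ (suc (suc r))) λ π → π ⟨$⟩ʳ 0F ≡ u × π ⟨$⟩ʳ 1F ≡ v
ends-to {u = u} u≢v = insert 0F u (insert 0F (punchOut u≢v) idₚ) , refl , punchIn-punchOut u≢v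

2≤half : ∀ D → 3 ≤ D + D → 2 ≤ D
2≤half (suc zero) (s≤s (s≤s ()))
2≤half (suc (suc D)) _ = s≤s (s≤s z≤n)

cubic-construction : ∀ {r} (G : Graph (suc (suc r))) D → (∀ x → deg G x ≡ 3) → HasGirth G (D + D) →
  ∀ {u v} → u ≢ v → DistAtLeast′ G u v D → (k : ℕ) (t : Fin 3) → 1 ≤ k →
  ThreeMGraph (k * r + extra t (suc (suc r))) (3 * k + toℕ t) (D + D)
cubic-construction G D cubic (hasCycle , no-shorter) u≢v far =
  Construction.construction D (2≤half D (Cycle.3≤L cycle)) (relabel G π) (λ x → trans (deg-relabel G π x) (cubic _))
    (girth-relabel G π no-shorter) (distAtLeast′-relabel G π (subst₂ (λ a b → DistAtLeast′ G a b D) (sym π₀) (sym π₁) far))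
    (cycle-relabel G π cycle)
  where
  cycle = hasCycle⇒cycle (D + D) hasCycle
  π = proj₁ (ends-to u≢v)
  π₀ = proj₁ (proj₂ (ends-to u≢v))
  π₁ = proj₂ (proj₂ (ends-to u≢v))

D*2≡D+D : ∀ D → D * 2 ≡ D + D
D*2≡D+D D = trans (*-comm D 2) (cong (D +_) (+-identityʳ D))

girth-half≥2 : ∀ {n} {G : Graph n} D → HasGirth G (D * 2) → 2 ≤ D
girth-half≥2 {G = G} D (hasCycle , _) = 2≤half D (subst (3 ≤_) (D*2≡D+D D) (Cycle.3≤L (hasCycle⇒cycle (D * 2) hasCycle)))

0<half : ∀ {n} {G : Graph n} D → HasGirth G (D * 2) → 0 < D * 2 / 2
0<half D girth = subst (0 <_) (sym (m*n/n≡m D 2)) (≤-trans (s≤s z≤n) (girth-half≥2 D girth))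

far⇒distinct : ∀ {n} {G : Graph n} {u v D} → 0 < D → DistAtLeast G u v D → u ≢ v
far⇒distinct 0<D far u≡v = far 0 0<D (walk′⇒walk (trivialWalk u≡v))

theorem1 : (g ng : ℕ) (G : Graph ng) → 2 ∣ g → (∀ v → deg G v ≡ 3) → HasGirth G g →
    Σ (Fin ng) (λ u → Σ (Fin ng) (λ v → DistAtLeast G u v (g / 2))) →
    (k : ℕ) (t : Fin 3) → 1 ≤ k →
    Σ (Graph (k * (ng ∸ 2) + extra t ng)) (λ H →
      HasGirth H g × (∀ v → deg H v ≡ 3 ⊎ deg H v ≡ 3 * k + toℕ t))
theorem1 g zero G _ _ _ (() , _)
theorem1 g (suc zero) G (divides D refl) _ girth (0F , 0F , far) =
  ⊥-elim (far⇒distinct (0<half D girth) far refl)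
theorem1 g (suc (suc r)) G (divides D refl) cubic girth (u , v , far) k t 1≤k =
  subst (ThreeMGraph (k * r + extra t (suc (suc r))) (3 * k + toℕ t)) (sym (D*2≡D+D D))
    (cubic-construction G D cubic (subst (HasGirth G) (D*2≡D+D D) girth) (far⇒distinct (0<half D girth) far) far′ k t 1≤k)
  where
  far′ : DistAtLeast′ G u v D
  far′ = distAtLeast⇒distAtLeast′ (subst (DistAtLeast G u v) (m*n/n≡m D 2) far)
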